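{- A graph or digraph with an orientable bi-eulerian embedding has no $2$-edge cut such that each component of the corresponding $2$-edge-cut reduction contains an odd number of vertices of degree congruent to $0$ mod $4$.
   Context: Graphs and digraphs are finite and may have loops and multiple edges/arcs; the degree of a vertex in a digraph is its total degree. For a connected graph $G$, a $2$-edge cut is a set $\{e,f\}$ of two edges each having one end in a proper nonempty subset $U\subset V(G)$ and the other end in $V(G)\setminus U$; for a digraph this is defined on arcs ignoring directions. Writing $e=\{e_1,e_2\}$, $f=\{f_1,f_2\}$ as pairs of half-edges with $e_1,f_1$ incident with vertices of $U$ and $e_2,f_2$ incident with vertices of $V(G)\setminus U$, the $2$-edge-cut reduction replaces $e,f$ by new edges joining the ends of $e_1,f_1$ and the ends of $e_2,f_2$, giving two components, one on $U$ and one on $V(G)\setminus U$ (in an eulerian digraph the cut has one arc in each direction, and the new arcs are oriented consistently with them). Embeddings are cellular in closed surfaces. A bi-eulerian embedding has exactly two faces, each bounded by an euler circuit (a directed euler circuit, in the digraph case). -}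

module Defs where

open import Data.Nat using (ℕ; zero; suc; _+_; _%_)
open import Data.Bool using (Bool; true; false; not; if_then_else_)
open import Data.Fin using (Fin; _≟_)
open import Data.List using (List; length; filter; allFin; map)
open import Data.Nat.ListAction using (sum)
open import Data.Product using (Σ; _×_; _,_; proj₁; proj₂; ∃; ∃-syntax)
open import Data.Sum using (_⊎_)
open import Relation.Nullary using (¬_; Dec; yes; no)
open import Relation.Nullary.Decidable using (⌊_⌋; _×-dec_)
open import Relation.Binary.PropositionalEquality using (_≡_; _≢_)
open import Data.Bool.Properties using () renaming (_≟_ to _≟B_)
open import Data.Nat.Properties using () renaming (_≟_ to _≟ℕ_)

-- For a digraph, (tail , head); for an
-- undirected graph the order is an arbitrary labelling of the two
-- half-edges.

record Graph : Set where
  field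
    nV   : ℕ
    nE   : ℕ
    ends : Fin nE → Fin nV × Fin nV
open Graph public

-- Half-edges (darts): (e , false) is the half-edge at proj₁ (ends e)
-- (the tail, for a digraph), (e , true) the one at proj₂ (ends e).
Dart : Graph → Set
Dart G = Fin (nE G) × Bool

vertexOf : (G : Graph) → Dart G → Fin (nV G)
vertexOf G (e , false) = proj₁ (ends G e)
vertexOf G (e , true)  = proj₂ (ends G e)

α : (G : Graph) → Dart G → Dart G
α G (e , b) = (e , not b)

-- degree: number of half-edges at v (a loop counts twice)
indicator : {n : ℕ} → Fin n → Fin n → ℕ
indicator u v with u ≟ v
... | yes _ = 1
... | no  _ = 0

degree : (G : Graph) → Fin (nV G) → ℕ
degree G v =
  sum (map (λ e → indicator (proj₁ (ends G e)) v + indicator (proj₂ (ends G e)) v)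
           (allFin (nE G)))

data Reachable (G : Graph) : Fin (nV G) → Fin (nV G) → Set where
  here : ∀ {u} → Reachable G u u
  step : ∀ {u w} (d : Dart G) → vertexOf G d ≡ u →
         Reachable G (vertexOf G (α G d)) w → Reachable G u w

Connected : Graph → Set
Connected G = ∀ u v → Reachable G u v

-- Orientable cellular embeddings, given combinatorially by rotation
-- systems (Heffter–Edmonds): a permutation σ of the darts whose
-- cycles are exactly the sets of darts at each vertex.

iter : {A : Set} → (A → A) → ℕ → A → A
iter f zero    x = x
iter f (suc k) x = f (iter f k x)

record RotationSystem (G : Graph) : Set where
  field
    σ        : Dart G → Dart G
    σ⁻¹      : Dart G → Dart G
    σ∘σ⁻¹    : ∀ d → σ (σ⁻¹ d) ≡ d
    σ⁻¹∘σ    : ∀ d → σ⁻¹ (σ d) ≡ d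
    σ-local  : ∀ d → vertexOf G (σ d) ≡ vertexOf G d
    σ-cyclic : ∀ d d' → vertexOf G d ≡ vertexOf G d' → ∃[ k ] iter σ k d ≡ d'
open RotationSystem public

-- face-tracing permutation: traverse dart d (from vertexOf d to
-- vertexOf (α d)), then continue with the next dart in the rotation
-- at that vertex.
φ : {G : Graph} → RotationSystem G → Dart G → Dart G
φ {G} R d = σ R (α G d)

SameFace : {G : Graph} → RotationSystem G → Dart G → Dart G → Set
SameFace R d d' = ∃[ k ] iter (φ R) k d ≡ d'

TwoFaces : (G : Graph) → RotationSystem G → Set
TwoFaces G R = Σ (Dart G) λ d₁ → Σ (Dart G) λ d₂ →
  ¬ SameFace R d₁ d₂ × (∀ d → SameFace R d₁ d ⊎ SameFace R d₂ d)

-- the facial walk through d is an euler circuit: it traverses every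
-- edge exactly once, i.e. contains exactly one of the two darts of
-- each edge.
FaceIsEuler : (G : Graph) → RotationSystem G → Dart G → Set
FaceIsEuler G R d = ∀ e →
  (SameFace R d (e , false) × ¬ SameFace R d (e , true)) ⊎
  (SameFace R d (e , true)  × ¬ SameFace R d (e , false))

BiEulerian : (G : Graph) → RotationSystem G → Set
BiEulerian G R = TwoFaces G R × (∀ d → FaceIsEuler G R d)

-- digraph version: each face boundary is a directed euler circuit,
-- i.e. (in one of its two traversal directions) every arc is traversed
-- from tail to head: all darts of the face are tail-darts or all are
-- head-darts.
DirectedBiEulerian : (G : Graph) → RotationSystem G → Set
DirectedBiEulerian G R =
  BiEulerian G R × (∀ d d' → SameFace R d d' → proj₂ d' ≡ proj₂ d)

Crosses : (G : Graph) → (Fin (nV G) → Bool) → Fin (nE G) → Set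
Crosses G U g = U (proj₁ (ends G g)) ≢ U (proj₂ (ends G g))

TwoEdgeCut : (G : Graph) → (Fin (nV G) → Bool) → Fin (nE G) → Fin (nE G) → Set
TwoEdgeCut G U e f =
  (∃[ u ] U u ≡ true) × (∃[ w ] U w ≡ false) × e ≢ f ×
  (∀ g → (Crosses G U g → g ≡ e ⊎ g ≡ f) × (g ≡ e ⊎ g ≡ f → Crosses G U g))

-- the half-edge of edge g whose end lies in U (resp. outside U)
sideIn : (G : Graph) → (Fin (nV G) → Bool) → Fin (nE G) → Bool
sideIn G U g = if U (proj₁ (ends G g)) then false else true

-- new edge formed from half-edges h₁ , h₂, oriented consistently
-- (the tail half-edge becomes the tail)
join : (G : Graph) → Dart G → Dart G → Fin (nV G) × Fin (nV G)
join G h₁ h₂ =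
  if proj₂ h₁ then (vertexOf G h₂ , vertexOf G h₁) else (vertexOf G h₁ , vertexOf G h₂)

-- the reduction: edge e is replaced by the new edge e₁f₁ (inside U),
-- edge f by the new edge e₂f₂ (outside U); the vertex set is unchanged,
-- the result being the disjoint union of the two components on U and on
-- V ∖ U.
reduce : (G : Graph) → (Fin (nV G) → Bool) → Fin (nE G) → Fin (nE G) → Graph
reduce G U e f = record
  { nV = nV G ; nE = nE G
  ; ends = λ g → if ⌊ g ≟ e ⌋
      then join G (e , sideIn G U e) (f , sideIn G U f)
      else (if ⌊ g ≟ f ⌋
      then join G (e , not (sideIn G U e)) (f , not (sideIn G U f))
      else ends G g) }

count0mod4 : (H : Graph) → (Fin (nV H) → Bool) → Bool → ℕ
count0mod4 H U b =
  length (filter (λ v → (U v ≟B b) ×-dec (degree H v % 4 ≟ℕ 0)) (allFin (nV H)))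

Odd : ℕ → Set
Odd k = k % 2 ≡ 1

BadCut : Graph → Set
BadCut G = Σ (Fin (nV G) → Bool) λ U → Σ (Fin (nE G)) λ e → Σ (Fin (nE G)) λ f →
  TwoEdgeCut G U e f ×
  Odd (count0mod4 (reduce G U e f) U true) ×
  Odd (count0mod4 (reduce G U e f) U false)

-- Colour each dart by the face containing it. Since each face is an euler circuit, the two darts
-- of an edge get different colours, and since φ = σ ∘ α preserves colours, the rotation σ at a
-- vertex alternates them: deg v = 2 h(v), where h(v) is the number of darts of the first colour
-- at v, so deg v ≡ 0 mod 4 iff h(v) is even. The reduction does not change degrees.
--
-- On the side U, σ together with the edge involution αU of the reduced component (eU and fU are
-- joined) is an orientable embedding of that component. A facial walk re-enters U only against
-- the colour it left with, so eU and fU have different colours and the two colour classes are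
-- exactly the two cycles of σ ∘ αU. By connectivity σ has |U| cycles on the darts in U, and each
-- of the |E_U| transpositions making up αU changes the parity of the number of cycles, whence
-- |U| + |E_U| ≡ 2 (Euler's formula mod 2), with |E_U| = Σ_{v ∈ U} h(v). The number of v ∈ U
-- with deg v ≡ 0 mod 4 is therefore ≡ Σ_{v ∈ U} (1 + h(v)) ≡ 0 mod 2.

module Submission where

open import Defs

open import Data.Bool using (Bool; true; false; not; _∧_; _∨_; if_then_else_)
open import Data.Bool.ListAction using (any)
open import Data.Bool.Properties using (not-involutive; ∧-zeroʳ; ∧-identityʳ; ¬-not; not-¬)
  renaming (_≟_ to _≟B_)
open import Data.Empty using (⊥; ⊥-elim)
open import Data.Fin using (Fin) renaming (_≟_ to _≟F_)
open import Data.List using (List; []; _∷_; length; map; filter; allFin)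
open import Data.List.Membership.Propositional using (_∈_; _∉_)
open import Data.List.Membership.Propositional.Properties
  using (∈-filter⁺; ∈-filter⁻; ∈-map⁺; ∈-map⁻; ∈-allFin)
open import Data.List.Membership.Propositional.Properties.WithK using (unique∧set⇒bag)
open import Data.List.Properties using (map-∘; map-cong-local)
open import Data.List.Relation.Binary.BagAndSetEquality using (∼bag⇒↭)
open import Data.List.Relation.Binary.Permutation.Propositional using (_↭_)
import Data.List.Relation.Binary.Permutation.Propositional.Properties as ↭
open import Data.List.Relation.Unary.All as All using (All; []; _∷_)
open import Data.List.Relation.Unary.Any using (here; there)
open import Data.List.Relation.Unary.Unique.Propositional using (Unique; []; _∷_)
import Data.List.Relation.Unary.Unique.Propositional.Properties as Unique
open import Data.Nat using (ℕ; zero; suc; _+_; _%_; _<_; _≤_; parity)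
open import Data.Nat.ListAction using (sum)
open import Data.Nat.ListAction.Properties using (sum-↭)
open import Data.Nat.Properties
  using (+-assoc; +-comm; +-suc; +-identityʳ; +-cancelʳ-≡; <-cmp; ≤-total; m≤n⇒∃[o]m+o≡n;
         +-commutativeSemigroup)
  renaming (_≟_ to _≟ℕ_)
open import Algebra.Properties.CommutativeSemigroup +-commutativeSemigroup
  using (interchange; xy∙z≈zy∙x; x∙yz≈xz∙y; x∙yz≈y∙xz)
open import Data.Parity using (0ℙ; 1ℙ; _⁻¹)
import Data.Parity as ℙ
import Data.Parity.Properties as ℙ
open import Data.Product using (_×_; _,_; proj₁; proj₂; ∃-syntax)
open import Data.Product.Properties using (≡-dec)
open import Data.Sum using (_⊎_; inj₁; inj₂; [_,_]′)
open import Function using (_∘_; id)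
open import Function.Bundles using (mk⇔)
open import Relation.Binary.Definitions using (DecidableEquality; tri<; tri≈; tri>)
open import Relation.Binary.PropositionalEquality
open import Relation.Nullary using (¬_; Dec; yes; no; does)
open import Relation.Nullary.Decidable using (dec-true; dec-false)

false≢true : false ≢ true
false≢true ()

𝟙 : Bool → ℕ
𝟙 true  = 1
𝟙 false = 0

count : {A : Set} → (A → Bool) → List A → ℕ
count P xs = sum (map (𝟙 ∘ P) xs)

private variable A B : Set

∈-tail : ∀ {x y : A} {xs} → x ∈ y ∷ xs → x ≢ y → x ∈ xs
∈-tail (here x≡y) x≢y = ⊥-elim (x≢y x≡y)
∈-tail (there x∈) _   = x∈

∉-tail : ∀ {x y : A} {xs} → All (y ≢_) xs → x ∈ xs → x ≢ y
∉-tail y∉ x∈ refl = All.lookup y∉ x∈ refl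

sum-map-+ : ∀ (f g : A → ℕ) xs →
            sum (map (λ x → f x + g x) xs) ≡ sum (map f xs) + sum (map g xs)
sum-map-+ f g [] = refl
sum-map-+ f g (x ∷ xs) = begin
  f x + g x + sum (map (λ x → f x + g x) xs)    ≡⟨ cong (f x + g x +_) (sum-map-+ f g xs) ⟩
  f x + g x + (sum (map f xs) + sum (map g xs)) ≡⟨ interchange (f x) (g x) _ _ ⟩
  f x + sum (map f xs) + (g x + sum (map g xs)) ∎
  where open ≡-Reasoning

sum-map-cong : ∀ {f g : A → ℕ} xs → (∀ {x} → x ∈ xs → f x ≡ g x) →
               sum (map f xs) ≡ sum (map g xs)
sum-map-cong xs f≗g = cong sum (map-cong-local (All.tabulate f≗g))

sum-map-comm : ∀ (F : A → B → ℕ) xs (ys : List B) →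
               sum (map (λ y → sum (map (λ x → F x y) xs)) ys) ≡
               sum (map (λ x → sum (map (F x) ys)) xs)
sum-map-comm F [] [] = refl
sum-map-comm F [] (y ∷ ys) = sum-map-comm F [] ys
sum-map-comm F (x ∷ xs) ys =
  trans (sum-map-+ (F x) (λ y → sum (map (λ x → F x y) xs)) ys)
        (cong (sum (map (F x) ys) +_) (sum-map-comm F xs ys))

sum-map-+-swap : ∀ (f g : A → ℕ) {x} xs → x ∈ xs → Unique xs →
                 (∀ {y} → y ∈ xs → y ≢ x → f y ≡ g y) →
                 sum (map f xs) + g x ≡ sum (map g xs) + f x
sum-map-+-swap f g (y ∷ xs) (here refl) (y∉ ∷ _) f≗g = begin
  f y + sum (map f xs) + g y ≡⟨ cong (λ s → f y + s + g y) (sum-map-cong xs agree) ⟩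
  f y + sum (map g xs) + g y ≡⟨ xy∙z≈zy∙x (f y) _ (g y) ⟩
  g y + sum (map g xs) + f y ∎
  where
  open ≡-Reasoning
  agree : ∀ {z} → z ∈ xs → f z ≡ g z
  agree z∈ = f≗g (there z∈) (∉-tail y∉ z∈)
sum-map-+-swap f g {x} (y ∷ xs) (there x∈) (y∉ ∷ u) f≗g = begin
  f y + sum (map f xs) + g x   ≡⟨ +-assoc (f y) _ _ ⟩
  f y + (sum (map f xs) + g x) ≡⟨ cong₂ _+_ (f≗g (here refl) (∉-tail y∉ x∈ ∘ sym)) IH ⟩
  g y + (sum (map g xs) + f x) ≡⟨ +-assoc (g y) _ _ ⟨
  g y + sum (map g xs) + f x   ∎
  where
  open ≡-Reasoning
  IH = sum-map-+-swap f g xs x∈ u (f≗g ∘ there)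

sum-map-exchange : ∀ (f g : A → ℕ) {a b} xs → a ∈ xs → b ∈ xs → a ≢ b → Unique xs →
                   (∀ {y} → y ∈ xs → y ≢ a → y ≢ b → f y ≡ g y) →
                   f a + f b ≡ g a + g b → sum (map f xs) ≡ sum (map g xs)
sum-map-exchange f g {a} {b} (y ∷ xs) a∈ b∈ a≢b (y∉ ∷ u) f≗g fab≡gab = cases a∈ b∈
  where
  notHead : ∀ {z} → z ∈ xs → z ≢ y
  notHead = ∉-tail y∉
  atHead : ∀ c d → d ∈ xs → f c + f d ≡ g c + g d → (∀ {z} → z ∈ xs → z ≢ d → f z ≡ g z) →
           f c + sum (map f xs) ≡ g c + sum (map g xs)
  atHead c d d∈ fcd≡gcd agree = +-cancelʳ-≡ _ _ _ (begin
    f c + sum (map f xs) + g d   ≡⟨ +-assoc (f c) _ _ ⟩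
    f c + (sum (map f xs) + g d) ≡⟨ cong (f c +_) (sum-map-+-swap f g xs d∈ u agree) ⟩
    f c + (sum (map g xs) + f d) ≡⟨ x∙yz≈xz∙y (f c) _ (f d) ⟩
    f c + f d + sum (map g xs)   ≡⟨ cong (_+ sum (map g xs)) fcd≡gcd ⟩
    g c + g d + sum (map g xs)   ≡⟨ x∙yz≈xz∙y (g c) _ (g d) ⟨
    g c + (sum (map g xs) + g d) ≡⟨ +-assoc (g c) _ _ ⟨
    g c + sum (map g xs) + g d   ∎)
    where open ≡-Reasoning
  cases : a ∈ y ∷ xs → b ∈ y ∷ xs → f y + sum (map f xs) ≡ g y + sum (map g xs)
  cases (here refl) (here refl) = ⊥-elim (a≢b refl)
  cases (here refl) (there b∈xs) =
    atHead a b b∈xs fab≡gab (λ z∈ z≢b → f≗g (there z∈) (notHead z∈) z≢b)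
  cases (there a∈xs) (here refl) =
    atHead b a a∈xs (trans (+-comm (f b) (f a)) (trans fab≡gab (+-comm (g a) (g b))))
           (λ z∈ z≢a → f≗g (there z∈) z≢a (notHead z∈))
  cases (there a∈xs) (there b∈xs) =
    cong₂ _+_ (f≗g (here refl) (notHead a∈xs ∘ sym) (notHead b∈xs ∘ sym))
              (sum-map-exchange f g xs a∈xs b∈xs a≢b u (f≗g ∘ there) fab≡gab)

length-filter≡count : ∀ {P : A → Set} (P? : ∀ x → Dec (P x)) xs →
                      length (filter P? xs) ≡ count (λ x → does (P? x)) xs
length-filter≡count P? [] = refl
length-filter≡count P? (x ∷ xs) with P? x
... | yes _ = cong suc (length-filter≡count P? xs)
... | no _  = length-filter≡count P? xs

does-≟-true : ∀ b → does (b ≟B true) ≡ b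
does-≟-true true  = refl
does-≟-true false = refl

length-filter-≟true : ∀ (P : A → Bool) xs → length (filter (λ x → P x ≟B true) xs) ≡ count P xs
length-filter-≟true P xs = trans (length-filter≡count (λ x → P x ≟B true) xs)
                                 (sum-map-cong xs (λ {x} _ → cong 𝟙 (does-≟-true (P x))))

count-filter : ∀ (P Q : A → Bool) xs →
               count P (filter (λ x → Q x ≟B true) xs) ≡ count (λ x → Q x ∧ P x) xs
count-filter P Q [] = refl
count-filter P Q (x ∷ xs) with Q x
... | true  = cong (𝟙 (P x) +_) (count-filter P Q xs)
... | false = count-filter P Q xs

count-split : ∀ (P Q : A → Bool) xs →
              count P xs ≡ count (λ x → P x ∧ Q x) xs + count (λ x → P x ∧ not (Q x)) xs
count-split P Q [] = refl
count-split P Q (x ∷ xs) with P x | Q x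
... | true  | true  = cong suc (count-split P Q xs)
... | true  | false = trans (cong suc (count-split P Q xs)) (sym (+-suc _ _))
... | false | _     = count-split P Q xs

count-false : ∀ (xs : List A) → count (λ _ → false) xs ≡ 0
count-false []       = refl
count-false (_ ∷ xs) = count-false xs

count-all : ∀ {P : A → Bool} xs → (∀ {x} → x ∈ xs → P x ≡ true) → count P xs ≡ length xs
count-all [] _ = refl
count-all {P = P} (x ∷ xs) all rewrite all (here refl) = cong suc (count-all xs (all ∘ there))

module _ (_≟_ : DecidableEquality A) where

  count-≟-∉ : ∀ {w} xs → w ∉ xs → count (λ y → does (w ≟ y)) xs ≡ 0
  count-≟-∉ [] _ = refl
  count-≟-∉ {w} (y ∷ xs) w∉ with w ≟ y
  ... | yes refl = ⊥-elim (w∉ (here refl))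
  ... | no _     = count-≟-∉ xs (w∉ ∘ there)

  count-≟-∈ : ∀ {w} xs → w ∈ xs → Unique xs → count (λ y → does (w ≟ y)) xs ≡ 1
  count-≟-∈ {w} (y ∷ xs) w∈ (y∉ ∷ u) with w ≟ y | w∈
  ... | yes refl | _        = cong suc (count-≟-∉ xs (λ w∈xs → ∉-tail y∉ w∈xs refl))
  ... | no w≢y   | here w≡y = ⊥-elim (w≢y w≡y)
  ... | no _     | there w∈xs = count-≟-∈ xs w∈xs u

  count-≟-∨ : ∀ {w} (Q : A → Bool) xs → w ∈ xs → Unique xs →
              count (λ y → does (w ≟ y) ∨ Q y) xs ≡ 𝟙 (not (Q w)) + count Q xs
  count-≟-∨ {w} Q (y ∷ xs) w∈ (y∉ ∷ u) with w ≟ y | w∈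
  ... | yes refl | _ = begin
    suc (count (λ z → does (w ≟ z) ∨ Q z) xs) ≡⟨ cong suc (sum-map-cong xs (λ z∈ →
                                                   cong (λ b → 𝟙 (b ∨ Q _)) (dec-false (w ≟ _) (∉-tail y∉ z∈ ∘ sym)))) ⟩
    suc (count Q xs)                          ≡⟨ suc≡𝟙-not+𝟙 (Q w) ⟩
    𝟙 (not (Q w)) + (𝟙 (Q w) + count Q xs)    ∎
    where
    open ≡-Reasoning
    suc≡𝟙-not+𝟙 : ∀ b → suc (count Q xs) ≡ 𝟙 (not b) + (𝟙 b + count Q xs)
    suc≡𝟙-not+𝟙 true  = refl
    suc≡𝟙-not+𝟙 false = refl
  ... | no w≢y   | here w≡y   = ⊥-elim (w≢y w≡y)
  ... | no _     | there w∈xs = begin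
    𝟙 (Q y) + count (λ z → does (w ≟ z) ∨ Q z) xs ≡⟨ cong (𝟙 (Q y) +_) (count-≟-∨ Q xs w∈xs u) ⟩
    𝟙 (Q y) + (𝟙 (not (Q w)) + count Q xs)        ≡⟨ x∙yz≈y∙xz (𝟙 (Q y)) (𝟙 (not (Q w))) (count Q xs) ⟩
    𝟙 (not (Q w)) + (𝟙 (Q y) + count Q xs)        ∎
    where open ≡-Reasoning

sum-map-∘-bijection : ∀ (f : A → ℕ) {π : A → A} (π⁻¹ : A → A) → (∀ y → π (π⁻¹ y) ≡ y) →
                      (∀ {x y} → π x ≡ π y → x ≡ y) →
                      ∀ {xs} → Unique xs → (∀ {x} → x ∈ xs → π x ∈ xs) → (∀ {x} → π x ∈ xs → x ∈ xs) →
                      sum (map (f ∘ π) xs) ≡ sum (map f xs)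
sum-map-∘-bijection f {π} π⁻¹ π∘π⁻¹ π-inj {xs} u closed closed⁻ = begin
  sum (map (f ∘ π) xs)     ≡⟨ cong sum (map-∘ xs) ⟩
  sum (map f (map π xs))   ≡⟨ sum-↭ (↭.map⁺ f πxs↭xs) ⟩
  sum (map f xs)           ∎
  where
  open ≡-Reasoning
  πxs↭xs : map π xs ↭ xs
  πxs↭xs = ∼bag⇒↭ (unique∧set⇒bag (Unique.map⁺ π-inj u) u (mk⇔ to from))
    where
    to : ∀ {y} → y ∈ map π xs → y ∈ xs
    to y∈ with ∈-map⁻ π y∈
    ... | x , x∈ , refl = closed x∈
    from : ∀ {y} → y ∈ xs → y ∈ map π xs
    from {y} y∈ = subst (_∈ map π xs) (π∘π⁻¹ y)
                        (∈-map⁺ π (closed⁻ (subst (_∈ xs) (sym (π∘π⁻¹ y)) y∈)))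

parity-sum-map-cong : ∀ {f g : A → ℕ} xs → (∀ {x} → x ∈ xs → parity (f x) ≡ parity (g x)) →
                      parity (sum (map f xs)) ≡ parity (sum (map g xs))
parity-sum-map-cong [] _ = refl
parity-sum-map-cong {f = f} {g} (x ∷ xs) f≗g = begin
  parity (f x + sum (map f xs))           ≡⟨ ℙ.+-homo-+ (f x) _ ⟩
  parity (f x) ℙ.+ parity (sum (map f xs)) ≡⟨ cong₂ ℙ._+_ (f≗g (here refl)) (parity-sum-map-cong xs (f≗g ∘ there)) ⟩
  parity (g x) ℙ.+ parity (sum (map g xs)) ≡⟨ ℙ.+-homo-+ (g x) _ ⟨
  parity (g x + sum (map g xs))           ∎
  where open ≡-Reasoning

parity-+-⁻¹ʳ : ∀ m {n n′} → parity n′ ≡ parity n ⁻¹ → parity (m + n′) ≡ parity (m + n) ⁻¹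
parity-+-⁻¹ʳ m {n} {n′} eq = begin
  parity (m + n′)             ≡⟨ ℙ.+-homo-+ m n′ ⟩
  parity m ℙ.+ parity n′      ≡⟨ cong (parity m ℙ.+_) eq ⟩
  parity m ℙ.+ parity n ⁻¹    ≡⟨ +-⁻¹ʳ (parity m) (parity n) ⟩
  (parity m ℙ.+ parity n) ⁻¹  ≡⟨ cong _⁻¹ (ℙ.+-homo-+ m n) ⟨
  parity (m + n) ⁻¹           ∎
  where
  open ≡-Reasoning
  +-⁻¹ʳ : ∀ p q → p ℙ.+ q ⁻¹ ≡ (p ℙ.+ q) ⁻¹
  +-⁻¹ʳ 0ℙ q = refl
  +-⁻¹ʳ 1ℙ q = refl

parity-suc : ∀ n → parity (suc n) ≡ parity n ⁻¹
parity-suc n = trans (sym (ℙ.⁻¹-involutive _)) (cong _⁻¹ (ℙ.suc-homo-⁻¹ n))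

parity-𝟙[2n%4≡0] : ∀ n → parity (𝟙 (does ((n + n) % 4 ≟ℕ 0))) ≡ parity (suc n)
parity-𝟙[2n%4≡0] zero          = refl
parity-𝟙[2n%4≡0] (suc zero)    = refl
parity-𝟙[2n%4≡0] (suc (suc n)) rewrite +-suc n (suc n) | +-suc n n = parity-𝟙[2n%4≡0] n

odd⇒parity≡1ℙ : ∀ k → Odd k → parity k ≡ 1ℙ
odd⇒parity≡1ℙ (suc zero)    _   = refl
odd⇒parity≡1ℙ (suc (suc k)) odd = odd⇒parity≡1ℙ k odd

iter-+ : ∀ (g : A → A) m n x → iter g (m + n) x ≡ iter g m (iter g n x)
iter-+ g zero    n x = refl
iter-+ g (suc m) n x = cong g (iter-+ g m n x)

iter-≤ : ∀ (g : A → A) {m n} → m ≤ n → ∀ x → ∃[ k ] iter g k (iter g m x) ≡ iter g n x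
iter-≤ g {m} m≤n x with m≤n⇒∃[o]m+o≡n m≤n
... | k , m+k≡n = k , trans (sym (iter-+ g k m x)) (cong (λ j → iter g j x) (trans (+-comm k m) m+k≡n))

-- Cycles of permutations of a list

module Permutations (_≟_ : DecidableEquality A) where

  record IsPermutation (xs : List A) (π : A → A) : Set where
    field
      closed     : ∀ {x} → x ∈ xs → π x ∈ xs
      injective  : ∀ {x y} → x ∈ xs → y ∈ xs → π x ≡ π y → x ≡ y
      surjective : ∀ {y} → y ∈ xs → ∃[ x ] (x ∈ xs × π x ≡ y)
  open IsPermutation public

  ∘-isPermutation : ∀ {xs π ρ} → IsPermutation xs π → IsPermutation xs ρ → IsPermutation xs (π ∘ ρ)
  ∘-isPermutation {π = π} P Q = record
    { closed     = closed P ∘ closed Q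
    ; injective  = λ x∈ y∈ eq → injective Q x∈ y∈ (injective P (closed Q x∈) (closed Q y∈) eq)
    ; surjective = λ y∈ →
        let (z , z∈ , πz≡y) = surjective P y∈
            (x , x∈ , ρx≡z) = surjective Q z∈
        in x , x∈ , trans (cong π ρx≡z) πz≡y
    }

  involution-isPermutation : ∀ {xs ι} → (∀ {x} → x ∈ xs → ι x ∈ xs) →
                             (∀ {x} → x ∈ xs → ι (ι x) ≡ x) → IsPermutation xs ι
  involution-isPermutation {ι = ι} closed′ invol = record
    { closed     = closed′
    ; injective  = λ x∈ y∈ eq → trans (sym (invol x∈)) (trans (cong ι eq) (invol y∈))
    ; surjective = λ y∈ → _ , closed′ y∈ , invol y∈
    }

  -- π with ℓ cut out of its cycle
  skip : A → (A → A) → A → A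
  skip ℓ π x = if does (π x ≟ ℓ) then π ℓ else π x

  skip-hit : ∀ ℓ π {x} → π x ≡ ℓ → skip ℓ π x ≡ π ℓ
  skip-hit ℓ π {x} πx≡ℓ with π x ≟ ℓ
  ... | yes _    = refl
  ... | no πx≢ℓ = ⊥-elim (πx≢ℓ πx≡ℓ)

  skip-miss : ∀ ℓ π {x} → π x ≢ ℓ → skip ℓ π x ≡ π x
  skip-miss ℓ π {x} πx≢ℓ with π x ≟ ℓ
  ... | yes πx≡ℓ = ⊥-elim (πx≢ℓ πx≡ℓ)
  ... | no _     = refl

  skip-isPermutation : ∀ {ℓ xs π} → Unique (ℓ ∷ xs) → IsPermutation (ℓ ∷ xs) π →
                       IsPermutation xs (skip ℓ π)
  skip-isPermutation {ℓ} {xs} {π} (ℓ∉ ∷ _) P = record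
    { closed = closed′ ; injective = injective′ ; surjective = surjective′ }
    where
    πℓ≢ℓ : ∀ {x} → x ∈ xs → π x ≡ ℓ → π ℓ ≢ ℓ
    πℓ≢ℓ x∈ πx≡ℓ πℓ≡ℓ = ∉-tail ℓ∉ x∈ (injective P (there x∈) (here refl) (trans πx≡ℓ (sym πℓ≡ℓ)))
    closed′ : ∀ {x} → x ∈ xs → skip ℓ π x ∈ xs
    closed′ {x} x∈ with π x ≟ ℓ
    ... | yes πx≡ℓ = ∈-tail (closed P (here refl)) (πℓ≢ℓ x∈ πx≡ℓ)
    ... | no πx≢ℓ  = ∈-tail (closed P (there x∈)) πx≢ℓ
    injective′ : ∀ {x y} → x ∈ xs → y ∈ xs → skip ℓ π x ≡ skip ℓ π y → x ≡ y
    injective′ {x} {y} x∈ y∈ eq with π x ≟ ℓ | π y ≟ ℓ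
    ... | yes πx≡ℓ | yes πy≡ℓ = injective P (there x∈) (there y∈) (trans πx≡ℓ (sym πy≡ℓ))
    ... | yes _    | no _     = ⊥-elim (∉-tail ℓ∉ y∈ (sym (injective P (here refl) (there y∈) eq)))
    ... | no _     | yes _    = ⊥-elim (∉-tail ℓ∉ x∈ (injective P (there x∈) (here refl) eq))
    ... | no _     | no _     = injective P (there x∈) (there y∈) eq
    surjective′ : ∀ {y} → y ∈ xs → ∃[ x ] (x ∈ xs × skip ℓ π x ≡ y)
    surjective′ {y} y∈ with surjective P (there y∈)
    ... | x , there x∈ , πx≡y =
          x , x∈ , trans (skip-miss ℓ π (λ πx≡ℓ → ∉-tail ℓ∉ y∈ (trans (sym πx≡y) πx≡ℓ))) πx≡y
    ... | _ , here refl , πℓ≡y =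
          let (w , w∈ , πw≡ℓ) = surjective P (here refl)
              w≢ℓ : w ≢ ℓ
              w≢ℓ w≡ℓ = ∉-tail ℓ∉ y∈ (trans (sym πℓ≡y) (trans (cong π (sym w≡ℓ)) πw≡ℓ))
          in w , ∈-tail w∈ w≢ℓ , trans (skip-hit ℓ π πw≡ℓ) πℓ≡y

  -- Cut out the head ℓ, counting a cycle when ℓ was a fixed point.
  cycles : List A → (A → A) → ℕ
  cycles []       π = 0
  cycles (ℓ ∷ xs) π = 𝟙 (does (π ℓ ≟ ℓ)) + cycles xs (skip ℓ π)

  cycles-cong : ∀ xs {π ρ} → (∀ {x} → x ∈ xs → π x ≡ ρ x) → cycles xs π ≡ cycles xs ρ
  cycles-cong [] _ = refl
  cycles-cong (ℓ ∷ xs) {π} {ρ} π≗ρ =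
    cong₂ _+_ (cong (λ y → 𝟙 (does (y ≟ ℓ))) (π≗ρ (here refl))) (cycles-cong xs skip≗)
    where
    skip≗ : ∀ {x} → x ∈ xs → skip ℓ π x ≡ skip ℓ ρ x
    skip≗ x∈ rewrite π≗ρ (there x∈) | π≗ρ (here refl) = refl

  skip-∘ : ∀ ℓ π {ρ} → ρ ℓ ≡ ℓ → ∀ x → skip ℓ (π ∘ ρ) x ≡ skip ℓ π (ρ x)
  skip-∘ ℓ π {ρ} ρℓ≡ℓ x with π (ρ x) ≟ ℓ
  ... | yes _ = cong π ρℓ≡ℓ
  ... | no _  = refl

  transpose : A → A → A → A
  transpose a b x = if does (x ≟ a) then b else if does (x ≟ b) then a else x

  transpose-a : ∀ a b → transpose a b a ≡ b
  transpose-a a b with a ≟ a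
  ... | yes _   = refl
  ... | no a≢a = ⊥-elim (a≢a refl)

  transpose-b : ∀ {a b} → a ≢ b → transpose a b b ≡ a
  transpose-b {a} {b} a≢b with b ≟ a | b ≟ b
  ... | yes b≡a | _      = ⊥-elim (a≢b (sym b≡a))
  ... | no _    | yes _  = refl
  ... | no _    | no b≢b = ⊥-elim (b≢b refl)

  transpose-other : ∀ {a b x} → x ≢ a → x ≢ b → transpose a b x ≡ x
  transpose-other {a} {b} {x} x≢a x≢b with x ≟ a | x ≟ b
  ... | yes x≡a | _       = ⊥-elim (x≢a x≡a)
  ... | no _    | yes x≡b = ⊥-elim (x≢b x≡b)
  ... | no _    | no _    = refl

  transpose-comm : ∀ {a b} → a ≢ b → ∀ x → transpose a b x ≡ transpose b a x
  transpose-comm {a} {b} a≢b x with x ≟ a | x ≟ b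
  ... | yes refl | yes refl = ⊥-elim (a≢b refl)
  ... | yes refl | no _     = refl
  ... | no _     | yes refl = refl
  ... | no _     | no _     = refl

  transpose-isPermutation : ∀ {xs a b} → a ∈ xs → b ∈ xs → a ≢ b → IsPermutation xs (transpose a b)
  transpose-isPermutation {xs} {a} {b} a∈ b∈ a≢b = involution-isPermutation closed′ involutive
    where
    closed′ : ∀ {x} → x ∈ xs → transpose a b x ∈ xs
    closed′ {x} x∈ with x ≟ a | x ≟ b
    ... | yes _ | _     = b∈
    ... | no _  | yes _ = a∈
    ... | no _  | no _  = x∈
    involutive : ∀ {x} → x ∈ xs → transpose a b (transpose a b x) ≡ x
    involutive {x} _ with x ≟ a | x ≟ b
    ... | yes refl | _        = transpose-b a≢b
    ... | no _     | yes refl = transpose-a a x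
    ... | no x≢a   | no x≢b   = transpose-other x≢a x≢b

  private
    module TransposeHead {ℓ xs π b} (ℓ∉ : All (ℓ ≢_) xs) (P : IsPermutation (ℓ ∷ xs) π) (b∈ : b ∈ xs) where

      τ = transpose ℓ b

      b≢ℓ : b ≢ ℓ
      b≢ℓ = ∉-tail ℓ∉ b∈

      τℓ≡b : τ ℓ ≡ b
      τℓ≡b = transpose-a ℓ b

      τb≡ℓ : τ b ≡ ℓ
      τb≡ℓ = transpose-b (b≢ℓ ∘ sym)

      pred∈xs⇒πℓ≢ℓ : ∀ {x} → x ∈ xs → π x ≡ ℓ → π ℓ ≢ ℓ
      pred∈xs⇒πℓ≢ℓ x∈ πx≡ℓ πℓ≡ℓ = ∉-tail ℓ∉ x∈ (injective P (there x∈) (here refl) (trans πx≡ℓ (sym πℓ≡ℓ)))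

      skip-τ-miss : ∀ {x} → x ∈ xs → x ≢ b → π x ≢ ℓ → skip ℓ (π ∘ τ) x ≡ π x
      skip-τ-miss x∈ x≢b πx≢ℓ =
        trans (skip-miss ℓ (π ∘ τ) (πx≢ℓ ∘ trans (cong π (sym τx≡x)))) (cong π τx≡x)
        where τx≡x = transpose-other (∉-tail ℓ∉ x∈) x≢b

      skip-τ-b : π ℓ ≢ ℓ → skip ℓ (π ∘ τ) b ≡ π ℓ
      skip-τ-b πℓ≢ℓ = trans (skip-miss ℓ (π ∘ τ) (πℓ≢ℓ ∘ trans (cong π (sym τb≡ℓ)))) (cong π τb≡ℓ)

      skip-τ≗skip : skip ℓ (π ∘ τ) b ≡ skip ℓ π b → (∀ {x} → x ∈ xs → x ≢ b → π x ≢ ℓ) →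
                    ∀ {x} → x ∈ xs → skip ℓ (π ∘ τ) x ≡ skip ℓ π x
      skip-τ≗skip at-b miss {x} x∈ = go (x ≟ b)
        where
        go : Dec (x ≡ b) → skip ℓ (π ∘ τ) x ≡ skip ℓ π x
        go (yes refl) = at-b
        go (no x≢b)   = trans (skip-τ-miss x∈ x≢b (miss x∈ x≢b)) (sym (skip-miss ℓ π (miss x∈ x≢b)))

      open ≡-Reasoning

      -- (ℓ b) joins the fixed point ℓ to the cycle of b.
      cycles-∘-transpose-fixed : π ℓ ≡ ℓ →
                                 parity (cycles (ℓ ∷ xs) (π ∘ τ)) ≡ parity (cycles (ℓ ∷ xs) π) ⁻¹
      cycles-∘-transpose-fixed πℓ≡ℓ = begin
        parity (𝟙 (does (π (τ ℓ) ≟ ℓ)) + cycles xs (skip ℓ (π ∘ τ)))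
          ≡⟨ cong parity (cong₂ _+_ (cong 𝟙 (dec-false (π (τ ℓ) ≟ ℓ) πτℓ≢ℓ))
                                    (cycles-cong xs (skip-τ≗skip at-b miss))) ⟩
        parity (cycles xs (skip ℓ π))
          ≡⟨ ℙ.suc-homo-⁻¹ (cycles xs (skip ℓ π)) ⟨
        parity (1 + cycles xs (skip ℓ π)) ⁻¹
          ≡⟨ cong (λ c → parity (𝟙 c + cycles xs (skip ℓ π)) ⁻¹) (dec-true (π ℓ ≟ ℓ) πℓ≡ℓ) ⟨
        parity (cycles (ℓ ∷ xs) π) ⁻¹
          ∎
        where
        πb≢ℓ : π b ≢ ℓ
        πb≢ℓ πb≡ℓ = pred∈xs⇒πℓ≢ℓ b∈ πb≡ℓ πℓ≡ℓ
        πτℓ≢ℓ : π (τ ℓ) ≢ ℓ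
        πτℓ≢ℓ = πb≢ℓ ∘ trans (cong π (sym τℓ≡b))
        at-b : skip ℓ (π ∘ τ) b ≡ skip ℓ π b
        at-b = trans (skip-hit ℓ (π ∘ τ) (trans (cong π τb≡ℓ) πℓ≡ℓ))
                     (trans (cong π τℓ≡b) (sym (skip-miss ℓ π πb≢ℓ)))
        miss : ∀ {x} → x ∈ xs → x ≢ b → π x ≢ ℓ
        miss x∈ _ πx≡ℓ = pred∈xs⇒πℓ≢ℓ x∈ πx≡ℓ πℓ≡ℓ

      -- (ℓ b) splits ℓ off the cycle of b as a fixed point.
      cycles-∘-transpose-pred : π ℓ ≢ ℓ → π b ≡ ℓ →
                                parity (cycles (ℓ ∷ xs) (π ∘ τ)) ≡ parity (cycles (ℓ ∷ xs) π) ⁻¹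
      cycles-∘-transpose-pred πℓ≢ℓ πb≡ℓ = begin
        parity (𝟙 (does (π (τ ℓ) ≟ ℓ)) + cycles xs (skip ℓ (π ∘ τ)))
          ≡⟨ cong parity (cong₂ _+_ (cong 𝟙 (dec-true (π (τ ℓ) ≟ ℓ) πτℓ≡ℓ))
                                    (cycles-cong xs (skip-τ≗skip at-b miss))) ⟩
        parity (1 + cycles xs (skip ℓ π))
          ≡⟨ parity-suc (cycles xs (skip ℓ π)) ⟩
        parity (cycles xs (skip ℓ π)) ⁻¹
          ≡⟨ cong (λ c → parity (𝟙 c + cycles xs (skip ℓ π)) ⁻¹) (dec-false (π ℓ ≟ ℓ) πℓ≢ℓ) ⟨
        parity (cycles (ℓ ∷ xs) π) ⁻¹
          ∎
        where
        πτℓ≡ℓ : π (τ ℓ) ≡ ℓ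
        πτℓ≡ℓ = trans (cong π τℓ≡b) πb≡ℓ
        at-b : skip ℓ (π ∘ τ) b ≡ skip ℓ π b
        at-b = trans (skip-τ-b πℓ≢ℓ) (sym (skip-hit ℓ π πb≡ℓ))
        miss : ∀ {x} → x ∈ xs → x ≢ b → π x ≢ ℓ
        miss x∈ x≢b πx≡ℓ = x≢b (injective P (there x∈) (there b∈) (trans πx≡ℓ (sym πb≡ℓ)))

      -- Otherwise, once ℓ is cut out, (ℓ b) acts on xs as (w b) for the predecessor w of ℓ.
      skip-τ≗skip-transpose : ∀ {w} → π w ≡ ℓ → w ∈ xs → w ≢ b → π ℓ ≢ ℓ → π b ≢ ℓ →
                              ∀ {x} → x ∈ xs → skip ℓ (π ∘ τ) x ≡ skip ℓ π (transpose w b x)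
      skip-τ≗skip-transpose {w} πw≡ℓ w∈ w≢b πℓ≢ℓ πb≢ℓ {x} x∈ = go (x ≟ w) (x ≟ b)
        where
        go : Dec (x ≡ w) → Dec (x ≡ b) → skip ℓ (π ∘ τ) x ≡ skip ℓ π (transpose w b x)
        go (yes refl) _ =
            trans (skip-hit ℓ (π ∘ τ) (trans (cong π (transpose-other (∉-tail ℓ∉ w∈) w≢b)) πw≡ℓ))
                  (trans (cong π τℓ≡b) (sym (trans (cong (skip ℓ π) (transpose-a x b)) (skip-miss ℓ π πb≢ℓ))))
        go (no _) (yes refl) =
            trans (skip-τ-b πℓ≢ℓ) (sym (trans (cong (skip ℓ π) (transpose-b w≢b)) (skip-hit ℓ π πw≡ℓ)))
        go (no x≢w) (no x≢b) =
            trans (skip-τ-miss x∈ x≢b πx≢ℓ)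
                  (sym (trans (cong (skip ℓ π) (transpose-other x≢w x≢b)) (skip-miss ℓ π πx≢ℓ)))
          where
          πx≢ℓ : π x ≢ ℓ
          πx≢ℓ πx≡ℓ = x≢w (injective P (there x∈) (there w∈) (trans πx≡ℓ (sym πw≡ℓ)))

  mutual
    cycles-∘-transpose : ∀ xs π {a b} → Unique xs → IsPermutation xs π → a ∈ xs → b ∈ xs → a ≢ b →
                         parity (cycles xs (π ∘ transpose a b)) ≡ parity (cycles xs π) ⁻¹
    cycles-∘-transpose (ℓ ∷ xs) π {a} {b} u P a∈ b∈ a≢b with a ≟ ℓ | b ≟ ℓ
    ... | yes refl | yes refl = ⊥-elim (a≢b refl)
    ... | yes refl | no b≢ℓ   = cycles-∘-transpose-head xs π u P (∈-tail b∈ b≢ℓ)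
    ... | no a≢ℓ   | yes refl =
          trans (cong parity (cycles-cong (ℓ ∷ xs) (λ {x} _ → cong π (transpose-comm a≢b x))))
                (cycles-∘-transpose-head xs π u P (∈-tail a∈ a≢ℓ))
    cycles-∘-transpose (ℓ ∷ xs) π {a} {b} u@(_ ∷ u′) P a∈ b∈ a≢b | no a≢ℓ | no b≢ℓ = begin
      parity (cycles (ℓ ∷ xs) (π ∘ τ))                       ≡⟨ cong parity (cong₂ _+_
                                                                  (cong (λ y → 𝟙 (does (π y ≟ ℓ))) τℓ≡ℓ)
                                                                  (cycles-cong xs (λ {x} _ → skip-∘ ℓ π τℓ≡ℓ x))) ⟩
      parity (𝟙 (does (π ℓ ≟ ℓ)) + cycles xs (skip ℓ π ∘ τ)) ≡⟨ parity-+-⁻¹ʳ (𝟙 (does (π ℓ ≟ ℓ)))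
                                                                  (cycles-∘-transpose xs (skip ℓ π) u′
                                                                    (skip-isPermutation u P)
                                                                    (∈-tail a∈ a≢ℓ) (∈-tail b∈ b≢ℓ) a≢b) ⟩
      parity (cycles (ℓ ∷ xs) π) ⁻¹                          ∎
      where
      open ≡-Reasoning
      τ = transpose a b
      τℓ≡ℓ : τ ℓ ≡ ℓ
      τℓ≡ℓ = transpose-other (a≢ℓ ∘ sym) (b≢ℓ ∘ sym)

    cycles-∘-transpose-head : ∀ {ℓ} xs π {b} → Unique (ℓ ∷ xs) → IsPermutation (ℓ ∷ xs) π → b ∈ xs →
                              parity (cycles (ℓ ∷ xs) (π ∘ transpose ℓ b)) ≡ parity (cycles (ℓ ∷ xs) π) ⁻¹
    cycles-∘-transpose-head {ℓ} xs π {b} u@(ℓ∉ ∷ u′) P b∈ = cases (π ℓ ≟ ℓ) (π b ≟ ℓ)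
      where
      open TransposeHead ℓ∉ P b∈
      open ≡-Reasoning
      cases : Dec (π ℓ ≡ ℓ) → Dec (π b ≡ ℓ) →
              parity (cycles (ℓ ∷ xs) (π ∘ τ)) ≡ parity (cycles (ℓ ∷ xs) π) ⁻¹
      cases (yes πℓ≡ℓ) _          = cycles-∘-transpose-fixed πℓ≡ℓ
      cases (no πℓ≢ℓ)  (yes πb≡ℓ) = cycles-∘-transpose-pred πℓ≢ℓ πb≡ℓ
      cases (no πℓ≢ℓ)  (no πb≢ℓ)  = begin
        parity (𝟙 (does (π (τ ℓ) ≟ ℓ)) + cycles xs (skip ℓ (π ∘ τ)))
          ≡⟨ cong parity (cong₂ _+_ (cong 𝟙 (dec-false (π (τ ℓ) ≟ ℓ) (πb≢ℓ ∘ trans (cong π (sym τℓ≡b)))))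
                                    (cycles-cong xs (skip-τ≗skip-transpose πw≡ℓ w∈ w≢b πℓ≢ℓ πb≢ℓ))) ⟩
        parity (cycles xs (skip ℓ π ∘ transpose w b))
          ≡⟨ cycles-∘-transpose xs (skip ℓ π) u′ (skip-isPermutation u P) w∈ b∈ w≢b ⟩
        parity (cycles xs (skip ℓ π)) ⁻¹
          ≡⟨ cong (λ c → parity (𝟙 c + cycles xs (skip ℓ π)) ⁻¹) (dec-false (π ℓ ≟ ℓ) πℓ≢ℓ) ⟨
        parity (cycles (ℓ ∷ xs) π) ⁻¹
          ∎
        where
        w = proj₁ (surjective P (here refl))
        πw≡ℓ : π w ≡ ℓ
        πw≡ℓ = proj₂ (proj₂ (surjective P (here refl)))
        w∈ : w ∈ xs
        w∈ = ∈-tail (proj₁ (proj₂ (surjective P (here refl)))) (λ w≡ℓ → πℓ≢ℓ (trans (cong π (sym w≡ℓ)) πw≡ℓ))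
        w≢b : w ≢ b
        w≢b w≡b = πb≢ℓ (trans (cong π (sym w≡b)) πw≡ℓ)

  transposeAlong : (A → A) → List A → A → A
  transposeAlong ι []       = id
  transposeAlong ι (a ∷ as) = transposeAlong ι as ∘ transpose a (ι a)

  module _ {xs : List A} {ι : A → A} where

    TranspositionsOn : List A → Set
    TranspositionsOn as = ∀ {a} → a ∈ as → a ∈ xs × ι a ∈ xs × a ≢ ι a

    transposeAlong-isPermutation : ∀ as → TranspositionsOn as → IsPermutation xs (transposeAlong ι as)
    transposeAlong-isPermutation []       _  = involution-isPermutation id (λ _ → refl)
    transposeAlong-isPermutation (a ∷ as) ok =
      let (a∈ , ιa∈ , a≢ιa) = ok (here refl)
      in ∘-isPermutation (transposeAlong-isPermutation as (ok ∘ there))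
                         (transpose-isPermutation a∈ ιa∈ a≢ιa)

    cycles-∘-transposeAlong : ∀ {π} as → Unique xs → IsPermutation xs π → TranspositionsOn as →
                              parity (cycles xs (π ∘ transposeAlong ι as)) ≡ parity (cycles xs π + length as)
    cycles-∘-transposeAlong {π} [] _ _ _ = cong parity (sym (+-identityʳ (cycles xs π)))
    cycles-∘-transposeAlong {π} (a ∷ as) u P ok = begin
      parity (cycles xs (π ∘ transposeAlong ι as ∘ transpose a (ι a)))
        ≡⟨ cycles-∘-transpose xs _ u (∘-isPermutation P (transposeAlong-isPermutation as (ok ∘ there)))
                              a∈ ιa∈ a≢ιa ⟩
      parity (cycles xs (π ∘ transposeAlong ι as)) ⁻¹
        ≡⟨ cong _⁻¹ (cycles-∘-transposeAlong as u P (ok ∘ there)) ⟩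
      parity (cycles xs π + length as) ⁻¹
        ≡⟨ parity-suc (cycles xs π + length as) ⟨
      parity (suc (cycles xs π + length as))
        ≡⟨ cong parity (+-suc (cycles xs π) (length as)) ⟨
      parity (cycles xs π + length (a ∷ as))
        ∎
      where
      open ≡-Reasoning
      a∈ = proj₁ (ok (here refl))
      ιa∈ = proj₁ (proj₂ (ok (here refl)))
      a≢ιa = proj₂ (proj₂ (ok (here refl)))

  module _ {xs : List A} {ι : A → A} (ι-closed : ∀ {x} → x ∈ xs → ι x ∈ xs)
           (ι-involutive : ∀ {x} → x ∈ xs → ι (ι x) ≡ x) where

    transposeAlong-outside : ∀ as → (∀ {a} → a ∈ as → a ∈ xs) →
                             ∀ {y} → y ∉ as → ι y ∉ as → transposeAlong ι as y ≡ y
    transposeAlong-outside []       _   _   _    = refl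
    transposeAlong-outside (a ∷ as) as⊆ {y} y∉ ιy∉ =
      trans (cong (transposeAlong ι as) (transpose-other (y∉ ∘ here) y≢ιa))
            (transposeAlong-outside as (as⊆ ∘ there) (y∉ ∘ there) (ιy∉ ∘ there))
      where
      y≢ιa : y ≢ ι a
      y≢ιa y≡ιa = ιy∉ (here (trans (cong ι y≡ιa) (ι-involutive (as⊆ (here refl)))))

    transposeAlong-inside : ∀ as → Unique as → (∀ {a} → a ∈ as → a ∈ xs) → (∀ {a} → a ∈ as → ι a ∉ as) →
                            ∀ {y} → y ∈ xs → y ∈ as ⊎ ι y ∈ as → transposeAlong ι as y ≡ ι y
    transposeAlong-inside []       _        _   _  _    (inj₁ ())
    transposeAlong-inside []       _        _   _  _    (inj₂ ())
    transposeAlong-inside (a ∷ as) (a∉ ∷ u) as⊆ ι∉ {y} y∈xs y∈ = go (y ≟ a) (y ≟ ι a)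
      where
      ιa∉ = ι∉ (here refl)
      ιιa≡a = ι-involutive (as⊆ (here refl))
      a≢ιa : a ≢ ι a
      a≢ιa a≡ιa = ιa∉ (here (sym a≡ιa))
      a∉as : a ∉ as
      a∉as a∈ = ∉-tail a∉ a∈ refl
      go : Dec (y ≡ a) → Dec (y ≡ ι a) → transposeAlong ι (a ∷ as) y ≡ ι y
      go (yes refl) _ =
        trans (cong (transposeAlong ι as) (transpose-a y (ι y)))
              (transposeAlong-outside as (as⊆ ∘ there) (ιa∉ ∘ there) (a∉as ∘ subst (_∈ as) ιιa≡a))
      go (no _) (yes refl) =
        trans (cong (transposeAlong ι as) (transpose-b a≢ιa))
              (trans (transposeAlong-outside as (as⊆ ∘ there) a∉as (ιa∉ ∘ there)) (sym ιιa≡a))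
      go (no y≢a) (no y≢ιa) =
        trans (cong (transposeAlong ι as) (transpose-other y≢a y≢ιa))
              (transposeAlong-inside as u (as⊆ ∘ there) (λ a∈ ιa∈ → ι∉ (there a∈) (there ιa∈)) y∈xs
                                     ([ (λ y∈′ → inj₁ (∈-tail y∈′ y≢a)) , (λ ιy∈ → inj₂ (∈-tail ιy∈ ιy≢a)) ]′ y∈))
        where
        ιy≢a : ι y ≢ a
        ιy≢a ιy≡a = y≢ιa (trans (sym (ι-involutive y∈xs)) (cong ι ιy≡a))

    -- as contains one point of each 2-cycle of ι, so ι is a product of length as transpositions.
    cycles-∘-involution : ∀ {π} as → Unique xs → IsPermutation xs π →
                          Unique as → (∀ {a} → a ∈ as → a ∈ xs) → (∀ {a} → a ∈ as → ι a ∉ as) →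
                          (∀ {y} → y ∈ xs → y ∈ as ⊎ ι y ∈ as) →
                          parity (cycles xs (π ∘ ι)) ≡ parity (cycles xs π + length as)
    cycles-∘-involution {π} as u P u-as as⊆ ι∉ half = begin
      parity (cycles xs (π ∘ ι))
        ≡⟨ cong parity (cycles-cong xs (λ y∈ → cong π (sym (transposeAlong-inside as u-as as⊆ ι∉ y∈ (half y∈))))) ⟩
      parity (cycles xs (π ∘ transposeAlong ι as))
        ≡⟨ cycles-∘-transposeAlong as u P valid ⟩
      parity (cycles xs π + length as)
        ∎
      where
      open ≡-Reasoning
      valid : TranspositionsOn {xs} {ι} as
      valid a∈ = as⊆ a∈ , ι-closed (as⊆ a∈) , λ a≡ιa → ι∉ a∈ (subst (_∈ as) a≡ιa a∈)

  Reach : (A → A) → A → A → Set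
  Reach π x y = ∃[ k ] iter π k x ≡ y

  skip-reach : ∀ ℓ π {x y} → x ≢ ℓ → y ≢ ℓ → Reach π x y → Reach (skip ℓ π) x y
  skip-reach ℓ π {x} {y} x≢ℓ y≢ℓ (k , πᵏx≡y) =
    proj₁ (walk k) , trans (proj₂ (walk k)) (trans (if-miss k (y≢ℓ ∘ trans (sym πᵏx≡y))) πᵏx≡y)
    where
    -- where the walk of skip ℓ π stands once π has made k steps
    target : ℕ → A
    target k = if does (iter π k x ≟ ℓ) then iter π (suc k) x else iter π k x
    if-miss : ∀ k → iter π k x ≢ ℓ → target k ≡ iter π k x
    if-miss k ne with iter π k x ≟ ℓ
    ... | yes eq = ⊥-elim (ne eq)
    ... | no _   = refl
    if-hit : ∀ k → iter π k x ≡ ℓ → target k ≡ iter π (suc k) x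
    if-hit k eq with iter π k x ≟ ℓ
    ... | yes _  = refl
    ... | no ne  = ⊥-elim (ne eq)
    walk : ∀ k → ∃[ j ] iter (skip ℓ π) j x ≡ target k
    walk zero = 0 , sym (if-miss 0 x≢ℓ)
    walk (suc k) = advance (walk k) (iter π k x ≟ ℓ) (iter π (suc k) x ≟ ℓ)
      where
      advance : ∃[ j ] iter (skip ℓ π) j x ≡ target k → Dec (iter π k x ≡ ℓ) → Dec (iter π (suc k) x ≡ ℓ) →
             ∃[ j ] iter (skip ℓ π) j x ≡ target (suc k)
      advance (j , eq) (no ne) (no ne′) =
        suc j , trans (cong (skip ℓ π) (trans eq (if-miss k ne)))
                      (trans (skip-miss ℓ π ne′) (sym (if-miss (suc k) ne′)))
      advance (j , eq) (no ne) (yes eq′) =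
        suc j , trans (cong (skip ℓ π) (trans eq (if-miss k ne)))
                      (trans (skip-hit ℓ π eq′) (sym (trans (if-hit (suc k) eq′) (cong π eq′))))
      advance (j , eq) (yes eq₀) (no ne′) =
        j , trans eq (trans (if-hit k eq₀) (sym (if-miss (suc k) ne′)))
      advance (j , eq) (yes eq₀) (yes eq′) =
        j , trans eq (trans (if-hit k eq₀)
              (sym (trans (if-hit (suc k) eq′) (trans (cong π eq′) (cong π (sym eq₀))))))

  iter-closed : ∀ {xs π} → IsPermutation xs π → ∀ k {x} → x ∈ xs → iter π k x ∈ xs
  iter-closed P zero    x∈ = x∈
  iter-closed P (suc k) x∈ = closed P (iter-closed P k x∈)

  iter-fixed : ∀ (π : A → A) {ℓ} → π ℓ ≡ ℓ → ∀ k → iter π k ℓ ≡ ℓ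
  iter-fixed π πℓ≡ℓ zero    = refl
  iter-fixed π πℓ≡ℓ (suc k) = trans (cong π (iter-fixed π πℓ≡ℓ k)) πℓ≡ℓ

  reach-fixed : ∀ {xs π ℓ} → IsPermutation xs π → ℓ ∈ xs → π ℓ ≡ ℓ →
                ∀ {x} → x ∈ xs → Reach π x ℓ ⊎ Reach π ℓ x → x ≡ ℓ
  reach-fixed {xs} {π} {ℓ} P ℓ∈ πℓ≡ℓ x∈ (inj₁ (k , πᵏx≡ℓ)) = back k x∈ πᵏx≡ℓ
    where
    back : ∀ k {x} → x ∈ xs → iter π k x ≡ ℓ → x ≡ ℓ
    back zero    _  eq = eq
    back (suc k) x∈ eq = back k x∈ (injective P (iter-closed P k x∈) ℓ∈ (trans eq (sym πℓ≡ℓ)))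
  reach-fixed {π = π} P ℓ∈ πℓ≡ℓ x∈ (inj₂ (k , πᵏℓ≡x)) = trans (sym πᵏℓ≡x) (iter-fixed π πℓ≡ℓ k)

  module _ {V : Set} (_≟V_ : DecidableEquality V) (colour : A → V) where

    private
      present : List A → V → Bool
      present xs v = any (λ x → does (colour x ≟V v)) xs

      present-intro : ∀ {v x} xs → x ∈ xs → colour x ≡ v → present xs v ≡ true
      present-intro {v} (y ∷ xs) (here refl) cx≡v rewrite dec-true (colour y ≟V v) cx≡v = refl
      present-intro {v} (y ∷ xs) (there x∈) cx≡v with does (colour y ≟V v)
      ... | true  = refl
      ... | false = present-intro xs x∈ cx≡v

      present-elim : ∀ {v} xs → present xs v ≡ true → ∃[ x ] (x ∈ xs × colour x ≡ v)
      present-elim {v} (y ∷ xs) h with colour y ≟V v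
      ... | yes cy≡v = y , here refl , cy≡v
      ... | no _     = let (x , x∈ , cx≡v) = present-elim xs h in x , there x∈ , cx≡v

    -- Cutting out the head ℓ loses its colour exactly when ℓ is a fixed point.
    cycles≡count-present : ∀ xs {π} vs → Unique xs → IsPermutation xs π →
                           (∀ {x} → x ∈ xs → colour (π x) ≡ colour x) →
                           (∀ {x y} → x ∈ xs → y ∈ xs → colour x ≡ colour y → Reach π x y ⊎ Reach π y x) →
                           Unique vs → (∀ {x} → x ∈ xs → colour x ∈ vs) →
                           cycles xs π ≡ count (present xs) vs
    cycles≡count-present [] vs _ _ _ _ _ _ = sym (count-false vs)
    cycles≡count-present (ℓ ∷ xs) {π} vs u@(ℓ∉ ∷ u′) P π-colour orbits u-vs colour∈ = begin
      𝟙 (does (π ℓ ≟ ℓ)) + cycles xs (skip ℓ π)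
        ≡⟨ cong₂ _+_ (cong 𝟙 fixed≡absent) IH ⟩
      𝟙 (not (present xs (colour ℓ))) + count (present xs) vs
        ≡⟨ count-≟-∨ _≟V_ (present xs) vs (colour∈ (here refl)) u-vs ⟨
      count (present (ℓ ∷ xs)) vs
        ∎
      where
      open ≡-Reasoning
      skip-colour : ∀ {x} → x ∈ xs → colour (skip ℓ π x) ≡ colour x
      skip-colour {x} x∈ with π x ≟ ℓ
      ... | yes πx≡ℓ = trans (π-colour (here refl)) (trans (cong colour (sym πx≡ℓ)) (π-colour (there x∈)))
      ... | no _     = π-colour (there x∈)
      skip-orbits : ∀ {x y} → x ∈ xs → y ∈ xs → colour x ≡ colour y →
                    Reach (skip ℓ π) x y ⊎ Reach (skip ℓ π) y x
      skip-orbits x∈ y∈ cx≡cy with orbits (there x∈) (there y∈) cx≡cy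
      ... | inj₁ r = inj₁ (skip-reach ℓ π (∉-tail ℓ∉ x∈) (∉-tail ℓ∉ y∈) r)
      ... | inj₂ r = inj₂ (skip-reach ℓ π (∉-tail ℓ∉ y∈) (∉-tail ℓ∉ x∈) r)
      IH : cycles xs (skip ℓ π) ≡ count (present xs) vs
      IH = cycles≡count-present xs vs u′ (skip-isPermutation u P) skip-colour skip-orbits u-vs (colour∈ ∘ there)
      fixed≡absent : does (π ℓ ≟ ℓ) ≡ not (present xs (colour ℓ))
      fixed≡absent with π ℓ ≟ ℓ | present xs (colour ℓ) in eq
      ... | yes _    | false = refl
      ... | no _     | true  = refl
      ... | no πℓ≢ℓ  | false =
            trans (sym eq) (present-intro xs (∈-tail (closed P (here refl)) πℓ≢ℓ) (π-colour (here refl)))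
      ... | yes πℓ≡ℓ | true  =
            let (x , x∈ , cx≡cℓ) = present-elim xs eq
            in ⊥-elim (∉-tail ℓ∉ x∈ (reach-fixed P (here refl) πℓ≡ℓ (there x∈) (orbits (there x∈) (here refl) cx≡cℓ)))

    cycles≡#colours : ∀ xs {π} vs → Unique xs → IsPermutation xs π →
                      (∀ {x} → x ∈ xs → colour (π x) ≡ colour x) →
                      (∀ {x y} → x ∈ xs → y ∈ xs → colour x ≡ colour y → Reach π x y ⊎ Reach π y x) →
                      Unique vs → (∀ {x} → x ∈ xs → colour x ∈ vs) →
                      (∀ {v} → v ∈ vs → ∃[ x ] (x ∈ xs × colour x ≡ v)) →
                      cycles xs π ≡ length vs
    cycles≡#colours xs vs u P π-colour orbits u-vs colour∈ onto =
      trans (cycles≡count-present xs vs u P π-colour orbits u-vs colour∈)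
            (count-all vs (λ v∈ → let (x , x∈ , cx≡v) = onto v∈ in present-intro xs x∈ cx≡v))

darts : ∀ {n} → List (Fin n) → List (Fin n × Bool)
darts []       = []
darts (g ∷ gs) = (g , false) ∷ (g , true) ∷ darts gs

∈-darts : ∀ {n} {gs : List (Fin n)} {g} b → g ∈ gs → (g , b) ∈ darts gs
∈-darts false (here refl) = here refl
∈-darts true  (here refl) = there (here refl)
∈-darts b     (there g∈)  = there (there (∈-darts b g∈))

∈-darts⁻ : ∀ {n} {gs : List (Fin n)} {g b} → (g , b) ∈ darts gs → g ∈ gs
∈-darts⁻ {gs = _ ∷ _} (here refl)         = here refl
∈-darts⁻ {gs = _ ∷ _} (there (here refl)) = here refl
∈-darts⁻ {gs = _ ∷ _} (there (there d∈))  = there (∈-darts⁻ d∈)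

darts-unique : ∀ {n} {gs : List (Fin n)} → Unique gs → Unique (darts gs)
darts-unique [] = []
darts-unique {gs = g ∷ gs} (g∉ ∷ u) =
  All.tabulate (λ { (here refl) () ; (there d∈) refl → ∉-tail g∉ (∈-darts⁻ d∈) refl })
  ∷ All.tabulate (λ { d∈ refl → ∉-tail g∉ (∈-darts⁻ d∈) refl })
  ∷ darts-unique u

count-darts : ∀ {n} (P : Fin n × Bool → Bool) gs →
              count P (darts gs) ≡ sum (map (λ g → 𝟙 (P (g , false)) + 𝟙 (P (g , true))) gs)
count-darts P []       = refl
count-darts P (g ∷ gs) =
  trans (sym (+-assoc (𝟙 (P (g , false))) _ _)) (cong (_ +_) (count-darts P gs))

module _ (G : Graph) where

  allDarts : List (Dart G)
  allDarts = darts (allFin (nE G))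

  ∈-allDarts : ∀ d → d ∈ allDarts
  ∈-allDarts (g , b) = ∈-darts b (∈-allFin g)

  allDarts-unique : Unique allDarts
  allDarts-unique = darts-unique (Unique.allFin⁺ (nE G))

  degree≡count-darts : ∀ v → degree G v ≡ count (λ d → does (vertexOf G d ≟F v)) allDarts
  degree≡count-darts v = trans (sum-map-cong (allFin (nE G)) (λ {g} _ →
                                  cong₂ _+_ (indicator≡𝟙 (proj₁ (ends G g))) (indicator≡𝟙 (proj₂ (ends G g)))))
                               (sym (count-darts _ (allFin (nE G))))
    where
    indicator≡𝟙 : ∀ u → indicator u v ≡ 𝟙 (does (u ≟F v))
    indicator≡𝟙 u with u ≟F v
    ... | yes _ = refl
    ... | no _  = refl

module _ (G : Graph) (U : Fin (nV G) → Bool) {e f : Fin (nE G)} (e≢f : e ≢ f) where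

  private
    H = reduce G U e f

    incidence : Fin (nV G) → Fin (nV G) × Fin (nV G) → ℕ
    incidence v (x , y) = indicator x v + indicator y v

    at : Fin (nV G) → Dart G → ℕ
    at v d = indicator (vertexOf G d) v

    incidence-join : ∀ v a b → incidence v (join G a b) ≡ at v a + at v b
    incidence-join v (g , true)  b = +-comm (at v b) (at v (g , true))
    incidence-join v (g , false) b = refl

    incidence-ends : ∀ v g s → incidence v (ends G g) ≡ at v (g , s) + at v (g , not s)
    incidence-ends v g false = refl
    incidence-ends v g true  = +-comm (at v (g , false)) (at v (g , true))

    ends-e : ends H e ≡ join G (e , sideIn G U e) (f , sideIn G U f)
    ends-e with e ≟F e
    ... | yes _   = refl
    ... | no e≢e = ⊥-elim (e≢e refl)

    ends-f : ends H f ≡ join G (e , not (sideIn G U e)) (f , not (sideIn G U f))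
    ends-f with f ≟F e | f ≟F f
    ... | yes f≡e | _      = ⊥-elim (e≢f (sym f≡e))
    ... | no _    | yes _  = refl
    ... | no _    | no f≢f = ⊥-elim (f≢f refl)

    ends-other : ∀ {g} → g ≢ e → g ≢ f → ends H g ≡ ends G g
    ends-other {g} g≢e g≢f with g ≟F e | g ≟F f
    ... | yes g≡e | _       = ⊥-elim (g≢e g≡e)
    ... | no _    | yes g≡f = ⊥-elim (g≢f g≡f)
    ... | no _    | no _    = refl

  -- The new edges are formed from the same four half-edges as e and f.
  degree-reduce : ∀ v → degree H v ≡ degree G v
  degree-reduce v = sum-map-exchange (incidence v ∘ ends H) (incidence v ∘ ends G) (allFin (nE G))
                      (∈-allFin e) (∈-allFin f) e≢f (Unique.allFin⁺ (nE G))
                      (λ _ g≢e g≢f → cong (incidence v) (ends-other g≢e g≢f)) halves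
    where
    s = sideIn G U e
    t = sideIn G U f
    open ≡-Reasoning
    halves : incidence v (ends H e) + incidence v (ends H f) ≡ incidence v (ends G e) + incidence v (ends G f)
    halves = begin
      incidence v (ends H e) + incidence v (ends H f)
        ≡⟨ cong₂ _+_ (trans (cong (incidence v) ends-e) (incidence-join v (e , s) (f , t)))
                     (trans (cong (incidence v) ends-f) (incidence-join v (e , not s) (f , not t))) ⟩
      at v (e , s) + at v (f , t) + (at v (e , not s) + at v (f , not t))
        ≡⟨ interchange (at v (e , s)) (at v (f , t)) (at v (e , not s)) (at v (f , not t)) ⟩
      at v (e , s) + at v (e , not s) + (at v (f , t) + at v (f , not t))
        ≡⟨ cong₂ _+_ (incidence-ends v e s) (incidence-ends v f t) ⟨
      incidence v (ends G e) + incidence v (ends G f) ∎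

count0mod4≡count : ∀ H U → count0mod4 H U true ≡
                   count (λ v → does (degree H v % 4 ≟ℕ 0)) (filter (λ v → U v ≟B true) (allFin (nV H)))
count0mod4≡count H U = begin
  count0mod4 H U true
    ≡⟨ length-filter≡count _ (allFin (nV H)) ⟩
  count (λ v → does (U v ≟B true) ∧ Z v) (allFin (nV H))
    ≡⟨ sum-map-cong (allFin (nV H)) (λ {v} _ → cong (λ b → 𝟙 (b ∧ Z v)) (does-≟-true (U v))) ⟩
  count (λ v → U v ∧ Z v) (allFin (nV H))
    ≡⟨ count-filter Z U (allFin (nV H)) ⟨
  count Z (filter (λ v → U v ≟B true) (allFin (nV H)))
    ∎
  where
  open ≡-Reasoning
  Z : Fin (nV H) → Bool
  Z v = does (degree H v % 4 ≟ℕ 0)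

α-involutive : ∀ G d → α G (α G d) ≡ d
α-involutive G (g , b) = cong (g ,_) (not-involutive b)

σ-injective : ∀ {G} (R : RotationSystem G) {x y} → σ R x ≡ σ R y → x ≡ y
σ-injective R {x} {y} eq = trans (sym (σ⁻¹∘σ R x)) (trans (cong (σ⁻¹ R) eq) (σ⁻¹∘σ R y))

-- The face colouring of a bi-eulerian embedding

module FaceColouring (G : Graph) (R : RotationSystem G) (be : BiEulerian G R) where

  private
    d₁ d₂ : Dart G
    d₁ = proj₁ (proj₁ be)
    d₂ = proj₁ (proj₂ (proj₁ be))

    covers : ∀ d → SameFace R d₁ d ⊎ SameFace R d₂ d
    covers = proj₂ (proj₂ (proj₂ (proj₁ be)))

    not-both-darts : ∀ {b} x → SameFace R b x → ¬ SameFace R b (α G x)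
    not-both-darts {b} (g , false) x∈ αx∈ with proj₂ be b g
    ... | inj₁ (_ , ∉) = ∉ αx∈
    ... | inj₂ (_ , ∉) = ∉ x∈
    not-both-darts {b} (g , true) x∈ αx∈ with proj₂ be b g
    ... | inj₁ (_ , ∉) = ∉ x∈
    ... | inj₂ (_ , ∉) = ∉ αx∈

    not-both-faces : ∀ x → SameFace R d₁ x → SameFace R d₂ x → ⊥
    not-both-faces x x∈₁ x∈₂ with covers (α G x)
    ... | inj₁ αx∈₁ = not-both-darts x x∈₁ αx∈₁
    ... | inj₂ αx∈₂ = not-both-darts x x∈₂ αx∈₂

    SameFace-φ : ∀ {b d} → SameFace R b d → SameFace R b (φ R d)
    SameFace-φ (k , φᵏb≡d) = suc k , cong (φ R) φᵏb≡d

  colour : Dart G → Bool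
  colour d = [ (λ _ → true) , (λ _ → false) ]′ (covers d)

  face : Dart G → Dart G
  face d = if colour d then d₁ else d₂

  face-cong : ∀ {x y} → colour x ≡ colour y → face x ≡ face y
  face-cong = cong (λ c → if c then d₁ else d₂)

  on-face : ∀ d → SameFace R (face d) d
  on-face d with covers d
  ... | inj₁ d∈₁ = d∈₁
  ... | inj₂ d∈₂ = d∈₂

  colour-α : ∀ d → colour (α G d) ≡ not (colour d)
  colour-α d with covers d | covers (α G d)
  ... | inj₁ d∈₁ | inj₁ αd∈₁ = ⊥-elim (not-both-darts d d∈₁ αd∈₁)
  ... | inj₁ _   | inj₂ _    = refl
  ... | inj₂ _   | inj₁ _    = refl
  ... | inj₂ d∈₂ | inj₂ αd∈₂ = ⊥-elim (not-both-darts d d∈₂ αd∈₂)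

  α-≢-same-colour : ∀ {x y} → colour x ≡ colour y → α G x ≢ y
  α-≢-same-colour {x} cx≡cy αx≡y = not-¬ (sym cx≡cy) (trans (cong colour (sym αx≡y)) (colour-α x))

  colour-φ : ∀ d → colour (φ R d) ≡ colour d
  colour-φ d with covers d | covers (φ R d)
  ... | inj₁ _   | inj₁ _    = refl
  ... | inj₁ d∈₁ | inj₂ φd∈₂ = ⊥-elim (not-both-faces (φ R d) (SameFace-φ d∈₁) φd∈₂)
  ... | inj₂ d∈₂ | inj₁ φd∈₁ = ⊥-elim (not-both-faces (φ R d) φd∈₁ (SameFace-φ d∈₂))
  ... | inj₂ _   | inj₂ _    = refl

  colour-σ : ∀ d → colour (σ R d) ≡ not (colour d)
  colour-σ d = begin
    colour (σ R d)               ≡⟨ cong (colour ∘ σ R) (α-involutive G d) ⟨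
    colour (φ R (α G d))         ≡⟨ colour-φ (α G d) ⟩
    colour (α G d)               ≡⟨ colour-α d ⟩
    not (colour d)               ∎
    where open ≡-Reasoning

  colour-iter-φ : ∀ k d → colour (iter (φ R) k d) ≡ colour d
  colour-iter-φ zero    d = refl
  colour-iter-φ (suc k) d = trans (colour-φ (iter (φ R) k d)) (colour-iter-φ k d)

  half-degree : Fin (nV G) → ℕ
  half-degree v = count (λ d → does (vertexOf G d ≟F v) ∧ colour d) (allDarts G)

  -- The rotation at v alternates between the two faces.
  degree≡2·half-degree : ∀ v → degree G v ≡ half-degree v + half-degree v
  degree≡2·half-degree v = begin
    degree G v                                                        ≡⟨ degree≡count-darts G v ⟩
    count at (allDarts G)                                             ≡⟨ count-split at colour (allDarts G) ⟩
    half-degree v + count (λ d → at d ∧ not (colour d)) (allDarts G) ≡⟨ cong (half-degree v +_) other-half ⟩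
    half-degree v + half-degree v                                     ∎
    where
    open ≡-Reasoning
    at : Dart G → Bool
    at d = does (vertexOf G d ≟F v)
    other-half : count (λ d → at d ∧ not (colour d)) (allDarts G) ≡ half-degree v
    other-half = begin
      count (λ d → at d ∧ not (colour d)) (allDarts G)
        ≡⟨ sum-map-cong (allDarts G) (λ {d} _ → cong 𝟙 (cong₂ _∧_ (cong (λ u → does (u ≟F v)) (sym (σ-local R d)))
                                                                 (sym (colour-σ d)))) ⟩
      count (λ d → at (σ R d) ∧ colour (σ R d)) (allDarts G)
        ≡⟨ sum-map-∘-bijection (λ d → 𝟙 (at d ∧ colour d)) (σ⁻¹ R) (σ∘σ⁻¹ R) (σ-injective R)
                               (allDarts-unique G) (λ _ → ∈-allDarts G _) (λ _ → ∈-allDarts G _) ⟩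
      half-degree v
        ∎

-- The side U of a 2-edge cut

module Cut (G : Graph) (R : RotationSystem G) (be : BiEulerian G R)
           (U : Fin (nV G) → Bool) {e f : Fin (nE G)} (cut : TwoEdgeCut G U e f) where

  _≟D_ : DecidableEquality (Dart G)
  _≟D_ = ≡-dec _≟F_ _≟B_

  open FaceColouring G R be
  open Permutations _≟D_

  inU : Dart G → Bool
  inU d = U (vertexOf G d)

  inU-σ : ∀ d → inU (σ R d) ≡ inU d
  inU-σ d = cong U (σ-local R d)

  in≢out : ∀ {x y} → inU x ≡ true → inU y ≡ false → x ≢ y
  in≢out x-in y-out x≡y = false≢true (trans (sym y-out) (trans (cong inU (sym x≡y)) x-in))

  e≢f : e ≢ f
  e≢f = proj₁ (proj₂ (proj₂ cut))

  eU eO fU fO : Dart G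
  eU = e , sideIn G U e
  eO = e , not (sideIn G U e)
  fU = f , sideIn G U f
  fO = f , not (sideIn G U f)

  private
    crosses : ∀ g → Crosses G U g → g ≡ e ⊎ g ≡ f
    crosses g = proj₁ (proj₂ (proj₂ (proj₂ cut)) g)

    sides : ∀ g → Crosses G U g → inU (g , sideIn G U g) ≡ true × inU (g , not (sideIn G U g)) ≡ false
    sides g g-crosses with U (proj₁ (ends G g)) in eq
    ... | true  = eq , ¬-not (g-crosses ∘ sym)
    ... | false = ¬-not (g-crosses ∘ sym) , eq

    e-crosses : Crosses G U e
    e-crosses = proj₂ (proj₂ (proj₂ (proj₂ cut)) e) (inj₁ refl)

    f-crosses : Crosses G U f
    f-crosses = proj₂ (proj₂ (proj₂ (proj₂ cut)) f) (inj₂ refl)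

  eU-in : inU eU ≡ true
  eU-in = proj₁ (sides e e-crosses)

  eO-out : inU eO ≡ false
  eO-out = proj₂ (sides e e-crosses)

  fU-in : inU fU ≡ true
  fU-in = proj₁ (sides f f-crosses)

  fO-out : inU fO ≡ false
  fO-out = proj₂ (sides f f-crosses)

  eU≢fU : eU ≢ fU
  eU≢fU = e≢f ∘ cong proj₁

  private
    cut-dart : ∀ {g b} → Crosses G U g → inU (g , b) ≡ true → b ≡ sideIn G U g
    cut-dart {g} {b} g-crosses d-in with b ≟B sideIn G U g
    ... | yes b≡s = b≡s
    ... | no b≢s  = ⊥-elim (in≢out d-in (proj₂ (sides g g-crosses)) (cong (g ,_) (¬-not b≢s)))

    uncrossed : ∀ {g} → g ≢ e → g ≢ f → ∀ b → inU (g , not b) ≡ inU (g , b)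
    uncrossed {g} g≢e g≢f b with U (proj₁ (ends G g)) ≟B U (proj₂ (ends G g))
    ... | no g-crosses = ⊥-elim ([ g≢e , g≢f ]′ (crosses g g-crosses))
    ... | yes ends≡ with b
    ...   | false = sym ends≡
    ...   | true  = ends≡

  exit : ∀ {d} → inU d ≡ true → inU (α G d) ≡ false → d ≡ eU ⊎ d ≡ fU
  exit {g , b} d-in αd-out with g ≟F e | g ≟F f
  ... | yes refl | _        = inj₁ (cong (g ,_) (cut-dart e-crosses d-in))
  ... | no _     | yes refl = inj₂ (cong (g ,_) (cut-dart f-crosses d-in))
  ... | no g≢e   | no g≢f   = ⊥-elim (false≢true (trans (sym αd-out) (trans (uncrossed g≢e g≢f b) d-in)))

  private
    φ-leaves : ∀ {d} → inU (α G d) ≡ false → inU (φ R d) ≡ false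
    φ-leaves {d} αd-out = trans (inU-σ (α G d)) αd-out

    φ-enters : ∀ {z} → inU z ≡ false → inU (φ R z) ≡ true → α G z ≡ eU ⊎ α G z ≡ fU
    φ-enters {z} z-out φz-in =
      exit (trans (sym (inU-σ (α G z))) φz-in) (trans (cong inU (α-involutive G z)) z-out)

    -- A facial walk enters U only along eO or fO. If eU and fU had the same colour, these would
    -- have the opposite one, so the face through eU could not come back to fU after leaving U.
    same-colour-absurd : colour eU ≡ colour fU → ⊥
    same-colour-absurd ceU≡cfU =
      compare (on-face eU) (subst (λ b → SameFace R b fU) (face-cong (sym ceU≡cfU)) (on-face fU))
      where
      b = face eU
      stays-out : ∀ {z} → colour z ≡ colour eU → inU z ≡ false → inU (φ R z) ≡ false
      stays-out {z} cz z-out with inU (φ R z) in φz-in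
      ... | false = refl
      ... | true  = ⊥-elim ([ α-≢-same-colour cz , α-≢-same-colour (trans cz ceU≡cfU) ]′
                               (φ-enters z-out φz-in))
      stays-out* : ∀ n {z} → colour z ≡ colour eU → inU z ≡ false → inU (iter (φ R) n z) ≡ false
      stays-out* zero    cz z-out = z-out
      stays-out* (suc n) {z} cz z-out = stays-out (trans (colour-iter-φ n z) cz) (stays-out* n cz z-out)
      escape : ∀ {x y kx ky} → iter (φ R) kx b ≡ x → iter (φ R) ky b ≡ y → kx < ky →
               inU (α G x) ≡ false → colour x ≡ colour eU → inU y ≡ true → ⊥
      escape {x} φᵏˣ≡x φᵏʸ≡y kx<ky αx-out cx y-in with iter-≤ (φ R) kx<ky b
      ... | n , φⁿφᵏˣ⁺¹≡φᵏʸ = in≢out y-in (stays-out* n (trans (colour-φ x) cx) (φ-leaves αx-out))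
                                 (trans (sym φᵏʸ≡y) (trans (sym φⁿφᵏˣ⁺¹≡φᵏʸ) (cong (iter (φ R) n ∘ φ R) φᵏˣ≡x)))
      compare : SameFace R b eU → SameFace R b fU → ⊥
      compare (k₁ , φᵏ¹≡eU) (k₂ , φᵏ²≡fU) with <-cmp k₁ k₂
      ... | tri< k₁<k₂ _ _ = escape φᵏ¹≡eU φᵏ²≡fU k₁<k₂ eO-out refl fU-in
      ... | tri≈ _ refl _  = eU≢fU (trans (sym φᵏ¹≡eU) φᵏ²≡fU)
      ... | tri> _ _ k₂<k₁ = escape φᵏ²≡fU φᵏ¹≡eU k₂<k₁ fO-out (sym ceU≡cfU) eU-in

  cut-darts-colour : colour fU ≡ not (colour eU)
  cut-darts-colour = ¬-not (same-colour-absurd ∘ sym)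

  -- The edge involution of the component on U of the reduction: its new edge has half-edges eU and fU.
  αU : Dart G → Dart G
  αU d = if does (d ≟D eU) then fU else if does (d ≟D fU) then eU else α G d

  αU-eU : αU eU ≡ fU
  αU-eU rewrite dec-true (eU ≟D eU) refl = refl

  αU-fU : αU fU ≡ eU
  αU-fU rewrite dec-false (fU ≟D eU) (eU≢fU ∘ sym) | dec-true (fU ≟D fU) refl = refl

  αU≡α : ∀ {d} → inU (α G d) ≡ true → αU d ≡ α G d
  αU≡α {d} αd-in rewrite dec-false (d ≟D eU) (in≢out αd-in eO-out ∘ cong (α G))
                       | dec-false (d ≟D fU) (in≢out αd-in fO-out ∘ cong (α G)) = refl

  αU-in : ∀ d → inU d ≡ true → inU (αU d) ≡ true
  αU-in d d-in with d ≟D eU | d ≟D fU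
  ... | yes _    | _        = fU-in
  ... | no _     | yes _    = eU-in
  ... | no d≢eU  | no d≢fU  with inU (α G d) in αd-in
  ...   | true  = refl
  ...   | false = ⊥-elim ([ d≢eU , d≢fU ]′ (exit d-in αd-in))

  αU-involutive : ∀ d → inU d ≡ true → αU (αU d) ≡ d
  αU-involutive d d-in with d ≟D eU | d ≟D fU
  ... | yes refl | _        = αU-fU
  ... | no _     | yes refl = αU-eU
  ... | no _     | no _     = trans (αU≡α (trans (cong inU (α-involutive G d)) d-in)) (α-involutive G d)

  colour-αU : ∀ d → inU d ≡ true → colour (αU d) ≡ not (colour d)
  colour-αU d d-in with d ≟D eU | d ≟D fU
  ... | yes refl | _        = cut-darts-colour
  ... | no _     | yes refl = trans (sym (not-involutive (colour eU))) (cong not (sym cut-darts-colour))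
  ... | no _     | no _     = colour-α d

  φU : Dart G → Dart G
  φU = σ R ∘ αU

  φU-in : ∀ d → inU d ≡ true → inU (φU d) ≡ true
  φU-in d d-in = trans (inU-σ (αU d)) (αU-in d d-in)

  colour-φU : ∀ d → inU d ≡ true → colour (φU d) ≡ colour d
  colour-φU d d-in = trans (colour-σ (αU d)) (trans (cong not (colour-αU d d-in)) (not-involutive (colour d)))

  iter-φU-in : ∀ {x} → inU x ≡ true → ∀ j → inU (iter φU j x) ≡ true
  iter-φU-in x-in zero        = x-in
  iter-φU-in {x} x-in (suc j) = φU-in (iter φU j x) (iter-φU-in x-in j)

  colour-iter-φU : ∀ {x} → inU x ≡ true → ∀ j → colour (iter φU j x) ≡ colour x
  colour-iter-φU x-in zero        = refl
  colour-iter-φU {x} x-in (suc j) = trans (colour-φU (iter φU j x) (iter-φU-in x-in j)) (colour-iter-φU x-in j)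

  -- Along the facial walk from x in U, darts in U are reached by φU as well; outside U we
  -- remember the cut dart through which the walk left U.
  Tracked : Dart G → Dart G → Set
  Tracked x w = (inU w ≡ true × Reach φU x w)
              ⊎ (inU w ≡ false × ∃[ c ] ((c ≡ eU ⊎ c ≡ fU) × Reach φU x c))

  private
    other-cut-dart : ∀ {c d} → c ≡ eU ⊎ c ≡ fU → d ≡ eU ⊎ d ≡ fU → d ≢ c → d ≡ αU c
    other-cut-dart (inj₁ refl) (inj₁ refl) d≢c = ⊥-elim (d≢c refl)
    other-cut-dart (inj₁ refl) (inj₂ refl) _   = sym αU-eU
    other-cut-dart (inj₂ refl) (inj₁ refl) _   = sym αU-fU
    other-cut-dart (inj₂ refl) (inj₂ refl) d≢c = ⊥-elim (d≢c refl)

    step-in : ∀ {x y} → inU y ≡ true → Reach φU x y → Tracked x (φ R y)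
    step-in {x} {y} y-in (j , φUʲx≡y) with inU (α G y) in αy-in
    ... | true  = inj₁ (trans (inU-σ (α G y)) αy-in , suc j , trans (cong φU φUʲx≡y) (cong (σ R) (αU≡α αy-in)))
    ... | false = inj₂ (trans (inU-σ (α G y)) αy-in , y , exit y-in αy-in , j , φUʲx≡y)

    step-out : ∀ {x z} → inU x ≡ true → colour z ≡ colour x → inU z ≡ false →
               ∃[ c ] ((c ≡ eU ⊎ c ≡ fU) × Reach φU x c) → Tracked x (φ R z)
    step-out {x} {z} x-in cz z-out (c , c-cut , j , φUʲx≡c) with inU (α G z) in αz-in
    ... | false = inj₂ (trans (inU-σ (α G z)) αz-in , c , c-cut , j , φUʲx≡c)
    ... | true  = inj₁ (trans (inU-σ (α G z)) αz-in , suc j , trans (cong φU φUʲx≡c) (cong (σ R) (sym αz≡αUc)))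
      where
      cc : colour c ≡ colour x
      cc = trans (cong colour (sym φUʲx≡c)) (colour-iter-φU x-in j)
      αz≡αUc : α G z ≡ αU c
      αz≡αUc = other-cut-dart c-cut (exit αz-in (trans (cong inU (α-involutive G z)) z-out))
                              (α-≢-same-colour (trans cz (sym cc)))

  tracked : ∀ {x} → inU x ≡ true → ∀ k → Tracked x (iter (φ R) k x)
  tracked x-in zero = inj₁ (x-in , 0 , refl)
  tracked {x} x-in (suc k) with tracked x-in k
  ... | inj₁ (y-in , r)      = step-in y-in r
  ... | inj₂ (z-out , c-cut) = step-out x-in (colour-iter-φ k x) z-out c-cut

  DU : List (Dart G)
  DU = filter (λ d → inU d ≟B true) (allDarts G)

  ∈-DU⁺ : ∀ {d} → inU d ≡ true → d ∈ DU
  ∈-DU⁺ d-in = ∈-filter⁺ (λ d → inU d ≟B true) (∈-allDarts G _) d-in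

  ∈-DU⁻ : ∀ {d} → d ∈ DU → inU d ≡ true
  ∈-DU⁻ d∈ = proj₂ (∈-filter⁻ (λ d → inU d ≟B true) {xs = allDarts G} d∈)

  DU-unique : Unique DU
  DU-unique = Unique.filter⁺ (λ d → inU d ≟B true) (allDarts-unique G)

  UV : List (Fin (nV G))
  UV = filter (λ v → U v ≟B true) (allFin (nV G))

  ∈-UV⁺ : ∀ {v} → U v ≡ true → v ∈ UV
  ∈-UV⁺ v-in = ∈-filter⁺ (λ v → U v ≟B true) (∈-allFin _) v-in

  ∈-UV⁻ : ∀ {v} → v ∈ UV → U v ≡ true
  ∈-UV⁻ v∈ = proj₂ (∈-filter⁻ (λ v → U v ≟B true) {xs = allFin (nV G)} v∈)

  UV-unique : Unique UV
  UV-unique = Unique.filter⁺ (λ v → U v ≟B true) (Unique.allFin⁺ (nV G))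

  σ-isPermutation : IsPermutation DU (σ R)
  σ-isPermutation = record
    { closed     = λ {d} d∈ → ∈-DU⁺ (trans (inU-σ d) (∈-DU⁻ d∈))
    ; injective  = λ _ _ → σ-injective R
    ; surjective = λ {y} y∈ → σ⁻¹ R y
                            , ∈-DU⁺ (trans (sym (inU-σ (σ⁻¹ R y))) (trans (cong inU (σ∘σ⁻¹ R y)) (∈-DU⁻ y∈)))
                            , σ∘σ⁻¹ R y
    }

  φU-isPermutation : IsPermutation DU φU
  φU-isPermutation = ∘-isPermutation σ-isPermutation
    (involution-isPermutation (λ {d} d∈ → ∈-DU⁺ (αU-in d (∈-DU⁻ d∈))) (λ {d} d∈ → αU-involutive d (∈-DU⁻ d∈)))

  φ-reach⇒φU-reach : ∀ {x y} n → inU x ≡ true → inU y ≡ true → iter (φ R) n x ≡ y → Reach φU x y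
  φ-reach⇒φU-reach n x-in y-in φⁿx≡y with tracked x-in n
  ... | inj₁ (_ , j , φUʲx≡φⁿx) = j , trans φUʲx≡φⁿx φⁿx≡y
  ... | inj₂ (φⁿx-out , _)      = ⊥-elim (in≢out y-in φⁿx-out (sym φⁿx≡y))

  private
    later⇒φU-reach : ∀ {b x y kx ky} → x ∈ DU → y ∈ DU → iter (φ R) kx b ≡ x → iter (φ R) ky b ≡ y →
                     kx ≤ ky → Reach φU x y
    later⇒φU-reach {b} x∈ y∈ φᵏˣ≡x φᵏʸ≡y kx≤ky with iter-≤ (φ R) kx≤ky b
    ... | n , φⁿφᵏˣ≡φᵏʸ = φ-reach⇒φU-reach n (∈-DU⁻ x∈) (∈-DU⁻ y∈)
                            (trans (cong (iter (φ R) n) (sym φᵏˣ≡x)) (trans φⁿφᵏˣ≡φᵏʸ φᵏʸ≡y))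

    same-face⇒φU-reach : ∀ {b x y} → x ∈ DU → y ∈ DU → SameFace R b x → SameFace R b y →
                         Reach φU x y ⊎ Reach φU y x
    same-face⇒φU-reach x∈ y∈ (kx , φᵏˣ≡x) (ky , φᵏʸ≡y) with ≤-total kx ky
    ... | inj₁ kx≤ky = inj₁ (later⇒φU-reach x∈ y∈ φᵏˣ≡x φᵏʸ≡y kx≤ky)
    ... | inj₂ ky≤kx = inj₂ (later⇒φU-reach y∈ x∈ φᵏʸ≡y φᵏˣ≡x ky≤kx)

  φU-orbits : ∀ {x y} → x ∈ DU → y ∈ DU → colour x ≡ colour y → Reach φU x y ⊎ Reach φU y x
  φU-orbits {x} {y} x∈ y∈ cx≡cy =
    same-face⇒φU-reach x∈ y∈ (on-face x) (subst (λ b → SameFace R b y) (face-cong (sym cx≡cy)) (on-face y))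

  cycles-φU : cycles DU φU ≡ 2
  cycles-φU = cycles≡#colours _≟B_ colour DU (true ∷ false ∷ []) DU-unique φU-isPermutation
                (λ {d} d∈ → colour-φU d (∈-DU⁻ d∈)) φU-orbits (((λ ()) ∷ []) ∷ [] ∷ []) (λ _ → bool∈ _) both
    where
    bool∈ : ∀ b → b ∈ true ∷ false ∷ []
    bool∈ true  = here refl
    bool∈ false = there (here refl)
    both : ∀ {b} → b ∈ true ∷ false ∷ [] → ∃[ d ] (d ∈ DU × colour d ≡ b)
    both {b} _ with colour eU ≟B b
    ... | yes ceU≡b = eU , ∈-DU⁺ eU-in , ceU≡b
    ... | no ceU≢b  = fU , ∈-DU⁺ fU-in , trans cut-darts-colour (sym (¬-not (ceU≢b ∘ sym)))

  cycles-σ : Connected G → cycles DU (σ R) ≡ length UV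
  cycles-σ conn = cycles≡#colours _≟F_ (vertexOf G) DU UV DU-unique σ-isPermutation
                    (λ {d} _ → σ-local R d) (λ {x} {y} _ _ vx≡vy → inj₁ (σ-cyclic R x y vx≡vy))
                    UV-unique (∈-UV⁺ ∘ ∈-DU⁻) dart-at
    where
    outside = proj₁ (proj₂ cut)
    dart-at : ∀ {v} → v ∈ UV → ∃[ d ] (d ∈ DU × vertexOf G d ≡ v)
    dart-at {v} v∈ with conn v (proj₁ outside)
    ... | here          = ⊥-elim (false≢true (trans (sym (proj₂ outside)) (∈-UV⁻ v∈)))
    ... | step d d-at _ = d , ∈-DU⁺ (trans (cong U d-at) (∈-UV⁻ v∈)) , d-at

  -- Euler's formula mod 2 for the embedding of the component on U: its vertices, edges and two faces
  -- are the cycles of σ, the pairs of αU and the cycles of φU.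
  euler-parity : Connected G → parity (length UV + count colour DU) ≡ 0ℙ
  euler-parity conn = begin
    parity (length UV + count colour DU)
      ≡⟨ cong parity (cong₂ _+_ (cycles-σ conn) (length-filter-≟true colour DU)) ⟨
    parity (cycles DU (σ R) + length half)
      ≡⟨ cycles-∘-involution (λ {d} d∈ → ∈-DU⁺ (αU-in d (∈-DU⁻ d∈))) (λ {d} d∈ → αU-involutive d (∈-DU⁻ d∈))
                             half DU-unique σ-isPermutation (Unique.filter⁺ (λ d → colour d ≟B true) DU-unique)
                             half⊆DU αU∉half in-half ⟨
    parity (cycles DU φU)
      ≡⟨ cong parity cycles-φU ⟩
    0ℙ
      ∎
    where
    open ≡-Reasoning
    half : List (Dart G)
    half = filter (λ d → colour d ≟B true) DU
    ∈-half⁻ : ∀ {d} → d ∈ half → d ∈ DU × colour d ≡ true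
    ∈-half⁻ = ∈-filter⁻ (λ d → colour d ≟B true) {xs = DU}
    half⊆DU : ∀ {d} → d ∈ half → d ∈ DU
    half⊆DU = proj₁ ∘ ∈-half⁻
    αU∉half : ∀ {d} → d ∈ half → αU d ∉ half
    αU∉half {d} d∈ αUd∈ = not-¬ (proj₂ (∈-half⁻ αUd∈))
                                 (trans (colour-αU d (∈-DU⁻ (half⊆DU d∈))) (cong not (proj₂ (∈-half⁻ d∈))))
    in-half : ∀ {d} → d ∈ DU → d ∈ half ⊎ αU d ∈ half
    in-half {d} d∈ with colour d in cd
    ... | true  = inj₁ (∈-filter⁺ (λ d → colour d ≟B true) d∈ cd)
    ... | false = inj₂ (∈-filter⁺ (λ d → colour d ≟B true) (∈-DU⁺ (αU-in d (∈-DU⁻ d∈)))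
                                   (trans (colour-αU d (∈-DU⁻ d∈)) (cong not cd)))

  sum-half-degree : sum (map half-degree UV) ≡ count colour DU
  sum-half-degree = begin
    sum (map half-degree UV)                          ≡⟨ sum-map-comm F (allDarts G) UV ⟩
    sum (map (λ d → sum (map (F d) UV)) (allDarts G)) ≡⟨ sum-map-cong (allDarts G) (λ {d} _ → sum-UV d) ⟩
    count (λ d → inU d ∧ colour d) (allDarts G)       ≡⟨ count-filter colour inU (allDarts G) ⟨
    count colour DU                                   ∎
    where
    open ≡-Reasoning
    F : Dart G → Fin (nV G) → ℕ
    F d v = 𝟙 (does (vertexOf G d ≟F v) ∧ colour d)
    occurrences : ∀ d → count (λ v → does (vertexOf G d ≟F v)) UV ≡ 𝟙 (inU d)
    occurrences d with inU d in d-in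
    ... | true  = count-≟-∈ _≟F_ UV (∈-UV⁺ d-in) UV-unique
    ... | false = count-≟-∉ _≟F_ UV (λ vd∈ → false≢true (trans (sym d-in) (∈-UV⁻ vd∈)))
    sum-UV : ∀ d → sum (map (F d) UV) ≡ 𝟙 (inU d ∧ colour d)
    sum-UV d with colour d
    ... | true  = trans (sum-map-cong UV (λ {v} _ → cong 𝟙 (∧-identityʳ (does (vertexOf G d ≟F v)))))
                        (trans (occurrences d) (cong 𝟙 (sym (∧-identityʳ (inU d)))))
    ... | false = trans (sum-map-cong UV (λ {v} _ → cong 𝟙 (∧-zeroʳ (does (vertexOf G d ≟F v)))))
                        (trans (count-false UV) (cong 𝟙 (sym (∧-zeroʳ (inU d)))))

  count0mod4-even : Connected G → parity (count0mod4 (reduce G U e f) U true) ≡ 0ℙ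
  count0mod4-even conn = begin
    parity (count0mod4 H U true)
      ≡⟨ cong parity (count0mod4≡count H U) ⟩
    parity (count (λ v → does (degree H v % 4 ≟ℕ 0)) UV)
      ≡⟨ parity-sum-map-cong UV (λ {v} _ → parity-𝟙-degree v) ⟩
    parity (sum (map (λ v → 1 + half-degree v) UV))
      ≡⟨ cong parity (sum-map-+ (λ _ → 1) half-degree UV) ⟩
    parity (count (λ _ → true) UV + sum (map half-degree UV))
      ≡⟨ cong parity (cong₂ _+_ (count-all UV (λ _ → refl)) sum-half-degree) ⟩
    parity (length UV + count colour DU)
      ≡⟨ euler-parity conn ⟩
    0ℙ
      ∎
    where
    open ≡-Reasoning
    H = reduce G U e f
    parity-𝟙-degree : ∀ v → parity (𝟙 (does (degree H v % 4 ≟ℕ 0))) ≡ parity (1 + half-degree v)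
    parity-𝟙-degree v = trans (cong (λ n → parity (𝟙 (does (n % 4 ≟ℕ 0))))
                                    (trans (degree-reduce G U e≢f v) (degree≡2·half-degree v)))
                              (parity-𝟙[2n%4≡0] (half-degree v))

no-bad-cut : (G : Graph) → Connected G → (R : RotationSystem G) → BiEulerian G R → ¬ BadCut G
no-bad-cut G conn R be (U , e , f , cut , odd-in-U , _) =
  ℙ.p≢p⁻¹ 0ℙ (trans (sym (Cut.count0mod4-even G R be U cut conn))
                    (odd⇒parity≡1ℙ (count0mod4 (reduce G U e f) U true) odd-in-U))

proposition3p4 : ((G : Graph) → Connected G → (R : RotationSystem G) → BiEulerian G R → ¬ BadCut G)
    × ((D : Graph) → Connected D → (R : RotationSystem D) → DirectedBiEulerian D R → ¬ BadCut D)
proposition3p4 = no-bad-cut , λ D conn R directed → no-bad-cut D conn R (proj₁ directed)
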